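{- Let $n\ge 3$ and $r$ be integers. If $r > \binom{\lceil 2\sqrt{n}\rceil}{2} \lfloor n/2 \rfloor + \lceil 2\sqrt{n}\rceil$, then ${\rm sg}(P_r\,\square\, C_n)= \lceil 2\sqrt{n}\, \rceil$.
   Context: $P_m$ denotes the path with vertex set $\{1,\dots,m\}$ and edges $\{i,i+1\}$; $C_n$ ($n\ge 3$) denotes the cycle with vertex set $\{1,\dots,n\}$ and edges $\{i,i+1\}$ and $\{n,1\}$. The Cartesian product $G\,\square\, H$ has vertex set $V(G)\times V(H)$, with $(g,h)$ adjacent to $(g',h')$ iff either $g=g'$ and $hh'\in E(H)$, or $h=h'$ and $gg'\in E(G)$. For a graph $G=(V,E)$ and $S\subseteq V$, for each pair $\{x,y\}\subseteq S$ with $x\neq y$ let $\widetilde{P}(x,y)$ be a selected fixed shortest $x,y$-path, and let $\widetilde{I}(S)=\{\widetilde{P}(x,y): x,y\in S\}$. $S$ is a strong geodetic set if for some such choice of geodesics, every vertex of $G$ lies on some path of $\widetilde{I}(S)$. The strong geodetic number ${\rm sg}(G)$ is the minimum cardinality of a strong geodetic set of $G$. -}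

module Defs where

open import Data.Nat using (ℕ; zero; suc; _+_; _*_; _≤_; _<_)
open import Data.Fin using (Fin; toℕ; _<_)
open import Data.Product using (Σ; _×_; _,_; ∃; ∃-syntax)
open import Data.Sum using (_⊎_)
open import Data.List using (List; length; lookup)
open import Data.List.Relation.Unary.Unique.Propositional using (Unique)
open import Relation.Binary.PropositionalEquality using (_≡_)

data Walk {V : Set} (E : V → V → Set) : V → V → ℕ → Set where
  here : ∀ {x} → Walk E x x 0
  step : ∀ {x y z k} → E x y → Walk E y z k → Walk E x z (suc k)

data OnWalk {V : Set} {E : V → V → Set} (v : V) : ∀ {x y k} → Walk E x y k → Set where
  on-here  : OnWalk v (here {x = v})
  on-start : ∀ {y z k} (e : E v y) (w : Walk E y z k) → OnWalk v (step e w)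
  on-later : ∀ {x y z k} (e : E x y) {w : Walk E y z k} → OnWalk v w → OnWalk v (step e w)

record Geodesic {V : Set} (E : V → V → Set) (x y : V) : Set where
  field
    len     : ℕ
    walk    : Walk E x y len
    minimal : ∀ {k} → Walk E x y k → len ≤ k

OnGeodesic : {V : Set} {E : V → V → Set} {x y : V} → V → Geodesic E x y → Set
OnGeodesic v g = OnWalk v (Geodesic.walk g)

-- S (a duplicate-free list of vertices) is a strong geodetic set: one fixed geodesic is
-- selected for each unordered pair {S_i, S_j} (i < j), and every vertex lies on one of them.
StrongGeodetic : {V : Set} (E : V → V → Set) (S : List V) → Set
StrongGeodetic {V} E S =
  Σ ((i j : Fin (length S)) → i Data.Fin.< j → Geodesic E (lookup S i) (lookup S j)) λ g →
    (v : V) → ∃[ i ] ∃[ j ] Σ (i Data.Fin.< j) λ p → OnGeodesic v (g i j p)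

SgEq : {V : Set} (E : V → V → Set) → ℕ → Set
SgEq {V} E k =
  (Σ (List V) λ S → Unique S × length S ≡ k × StrongGeodetic E S)
  × (∀ (S : List V) → Unique S → StrongGeodetic E S → k Data.Nat.≤ length S)

-- Path P_m on vertices 0..m-1 (i.e. 1..m shifted), edges {i,i+1}.
PathAdj : (m : ℕ) → Fin m → Fin m → Set
PathAdj m a b = (suc (toℕ a) ≡ toℕ b) ⊎ (suc (toℕ b) ≡ toℕ a)

CycleAdj : (n : ℕ) → Fin n → Fin n → Set
CycleAdj n a b = (suc (toℕ a) ≡ toℕ b) ⊎ (suc (toℕ b) ≡ toℕ a)
               ⊎ ((suc (toℕ a) ≡ n × toℕ b ≡ 0) ⊎ (suc (toℕ b) ≡ n × toℕ a ≡ 0))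

Box : {A B : Set} → (A → A → Set) → (B → B → Set) → (A × B) → (A × B) → Set
Box EG EH (g , h) (g' , h') = (g ≡ g' × EH h h') ⊎ (h ≡ h' × EG g g')

-- k = ⌈2√n⌉ : the least natural k with k ≥ 2√n, i.e. with 4n ≤ k².
IsCeil2Sqrt : ℕ → ℕ → Set
IsCeil2Sqrt n k = (4 * n ≤ k * k) × (∀ j → 4 * n ≤ j * j → k ≤ j)

module Submission where

-- Upper bound: put a = ⌈k/2⌉ vertices in the first row, at columns 0, …, a - 1, and b = ⌊k/2⌋
-- in the last row, one in each block of a consecutive columns (ab ≥ n, so the blocks cover C_n).
-- Each column lies entirely on a shortest path from a top vertex to the bottom vertex of its
-- block that runs along the first row, down that column and along the last row, going round the
-- cycle whichever way is shorter.
--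
-- Lower bound: if S is strong geodetic with |S| < k then |S|² < 4n.  A geodesic from row A to
-- row B has length at most |A - B| + ⌊n/2⌋, so over all the rows without a vertex of S it spends
-- at most ⌊n/2⌋ vertices beyond one per row it crosses.  Such an empty row holds n vertices to be
-- covered, yet at most |S|²/4 < n geodesics cross it.  Hence there are at most ⌊n/2⌋ C(|S|, 2)
-- empty rows and r ≤ |S| + ⌊n/2⌋ C(|S|, 2), contradicting the bound on r.

open import Data.Nat
  using (ℕ; zero; suc; _+_; _*_; _∸_; _≤_; _<_; z≤n; s≤s; _⊓_; _⊔_; ∣_-_∣; _≤?_; _<?_; _≟_;
         _/_; _%_; ⌊_/2⌋; ⌈_/2⌉; NonZero; >-nonZero)
open import Data.Nat.Properties
open import Algebra.Properties.CommutativeSemigroup +-commutativeSemigroup using (interchange)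
open import Data.Nat.DivMod using (m≡m%n+[m/n]*n; m%n<n; m<n*o⇒m/o<n; m*n/n≡m; /-monoˡ-≤)
open import Data.Nat.Combinatorics using (_C_; nC1≡n; nCk+nC[k+1]≡[n+1]C[k+1])
open import Data.Nat.Tactic.RingSolver using (solve-∀)
open import Data.Fin using (Fin; toℕ; fromℕ<)
import Data.Fin as F
open import Data.Fin.Properties using (toℕ<n; toℕ-injective; toℕ-fromℕ<)
open import Data.List using (List; length; lookup; applyUpTo)
open import Data.List.Properties using (length-applyUpTo; lookup-applyUpTo)
open import Data.List.Relation.Unary.Unique.Propositional using (Unique)
open import Data.List.Relation.Unary.Unique.Propositional.Properties using (applyUpTo⁺₁)
open import Data.Product using (Σ; _×_; _,_; proj₁; proj₂; ∃-syntax)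
open import Data.Sum using (_⊎_; inj₁; inj₂)
open import Data.Empty using (⊥-elim)
open import Function using (_∘_)
open import Relation.Nullary using (Dec; yes; no; ¬_)
open import Relation.Binary using (tri<; tri≈; tri>)
open import Relation.Binary.PropositionalEquality
open import Defs

-- Indicators and finite sums

𝟙 : {P : Set} → Dec P → ℕ
𝟙 (yes _) = 1
𝟙 (no _)  = 0

𝟙≤1 : {P : Set} (d : Dec P) → 𝟙 d ≤ 1
𝟙≤1 (yes _) = s≤s z≤n
𝟙≤1 (no _)  = z≤n

𝟙-yes : {P : Set} (d : Dec P) → P → 𝟙 d ≡ 1
𝟙-yes (yes _) _ = refl
𝟙-yes (no ¬p) p = ⊥-elim (¬p p)

𝟙-no : {P : Set} (d : Dec P) → ¬ P → 𝟙 d ≡ 0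
𝟙-no (yes p) ¬p = ⊥-elim (¬p p)
𝟙-no (no _)  _  = refl

𝟙-exclusive : {P Q : Set} (d : Dec P) (e : Dec Q) → (P → ¬ Q) → 𝟙 d + 𝟙 e ≤ 1
𝟙-exclusive (yes p) (yes q) excl = ⊥-elim (excl p q)
𝟙-exclusive (yes _) (no _)  _    = ≤-refl
𝟙-exclusive (no _)  (yes _) _    = ≤-refl
𝟙-exclusive (no _)  (no _)  _    = z≤n

𝟙-cong : {P Q : Set} (d : Dec P) (e : Dec Q) → (P → Q) → (Q → P) → 𝟙 d ≡ 𝟙 e
𝟙-cong (yes _) (yes _) _ _ = refl
𝟙-cong (yes p) (no ¬q) f _ = ⊥-elim (¬q (f p))
𝟙-cong (no ¬p) (yes q) _ g = ⊥-elim (¬p (g q))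
𝟙-cong (no _)  (no _)  _ _ = refl

𝟙-split : ∀ f x → f ≤ 1 → f * x + (1 ∸ f) * x ≡ x
𝟙-split zero          x _ = +-identityʳ x
𝟙-split (suc zero)    x _ = trans (+-identityʳ (x + 0)) (+-identityʳ x)
𝟙-split (suc (suc f)) x (s≤s ())

sumTo : ℕ → (ℕ → ℕ) → ℕ
sumTo zero    f = 0
sumTo (suc m) f = sumTo m f + f m

sumTo-mono : ∀ m {f g : ℕ → ℕ} → (∀ t → t < m → f t ≤ g t) → sumTo m f ≤ sumTo m g
sumTo-mono zero    h = z≤n
sumTo-mono (suc m) h = +-mono-≤ (sumTo-mono m (λ t t<m → h t (m<n⇒m<1+n t<m))) (h m ≤-refl)

sumTo-cong : ∀ m {f g : ℕ → ℕ} → (∀ t → t < m → f t ≡ g t) → sumTo m f ≡ sumTo m g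
sumTo-cong m h = ≤-antisym (sumTo-mono m (λ t lt → ≤-reflexive (h t lt)))
                           (sumTo-mono m (λ t lt → ≤-reflexive (sym (h t lt))))

sumTo-+ : ∀ m (f g : ℕ → ℕ) → sumTo m (λ t → f t + g t) ≡ sumTo m f + sumTo m g
sumTo-+ zero    f g = refl
sumTo-+ (suc m) f g rewrite sumTo-+ m f g = interchange (sumTo m f) (sumTo m g) (f m) (g m)

sumTo-*ˡ : ∀ m c (f : ℕ → ℕ) → sumTo m (λ t → c * f t) ≡ c * sumTo m f
sumTo-*ˡ zero    c f = sym (*-zeroʳ c)
sumTo-*ˡ (suc m) c f rewrite sumTo-*ˡ m c f = sym (*-distribˡ-+ c (sumTo m f) (f m))

sumTo-const : ∀ m c → sumTo m (λ _ → c) ≡ m * c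
sumTo-const zero    c = refl
sumTo-const (suc m) c rewrite sumTo-const m c = +-comm (m * c) c

sumTo-ones : ∀ m → sumTo m (λ _ → 1) ≡ m
sumTo-ones m = trans (sumTo-const m 1) (*-identityʳ m)

sumTo-zero : ∀ m (f : ℕ → ℕ) → (∀ t → t < m → f t ≡ 0) → sumTo m f ≡ 0
sumTo-zero m f h = trans (sumTo-cong m h) (trans (sumTo-const m 0) (*-zeroʳ m))

sumTo-𝟙≡ : ∀ m x → x < m → sumTo m (λ t → 𝟙 (x ≟ t)) ≡ 1
sumTo-𝟙≡ (suc m) x x<1+m with x ≟ m
... | yes refl = cong (_+ 1) (sumTo-zero m _ (λ t t<m → 𝟙-no (x ≟ t) (λ e → <-irrefl (sym e) t<m)))
... | no x≢m   = trans (+-identityʳ _) (sumTo-𝟙≡ m x (≤∧≢⇒< (≤-pred x<1+m) x≢m))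

sumTo-𝟙≥ : ∀ m lo → sumTo m (λ t → 𝟙 (lo ≤? t)) ≡ m ∸ lo
sumTo-𝟙≥ zero    lo = sym (0∸n≡0 lo)
sumTo-𝟙≥ (suc m) lo with lo ≤? m
... | yes lo≤m rewrite sumTo-𝟙≥ m lo = trans (+-comm (m ∸ lo) 1) (sym (+-∸-assoc 1 lo≤m))
... | no lo≰m  rewrite sumTo-𝟙≥ m lo =
  trans (+-identityʳ _) (trans (m≤n⇒m∸n≡0 (<⇒≤ (≰⇒> lo≰m))) (sym (m≤n⇒m∸n≡0 (≰⇒> lo≰m))))

sumTo-interval : ∀ m lo hi → lo ≤ hi → hi < m →
                 sumTo m (λ t → 𝟙 (lo ≤? t) * 𝟙 (t ≤? hi)) ≡ suc (hi ∸ lo)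
sumTo-interval (suc m) lo hi lo≤hi hi<1+m with hi ≟ m
... | yes refl = trans (cong₂ _+_ below top) (+-comm (hi ∸ lo) 1)
  where
  below : sumTo hi (λ t → 𝟙 (lo ≤? t) * 𝟙 (t ≤? hi)) ≡ hi ∸ lo
  below = trans (sumTo-cong hi (λ t t<hi → trans (cong (𝟙 (lo ≤? t) *_) (𝟙-yes (t ≤? hi) (<⇒≤ t<hi)))
                                                  (*-identityʳ _)))
                (sumTo-𝟙≥ hi lo)
  top : 𝟙 (lo ≤? hi) * 𝟙 (hi ≤? hi) ≡ 1
  top = cong₂ _*_ (𝟙-yes (lo ≤? hi) lo≤hi) (𝟙-yes (hi ≤? hi) ≤-refl)
... | no hi≢m = trans (cong₂ _+_ (sumTo-interval m lo hi lo≤hi hi<m) top) (+-identityʳ _)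
  where
  hi<m = ≤∧≢⇒< (≤-pred hi<1+m) hi≢m
  top : 𝟙 (lo ≤? m) * 𝟙 (m ≤? hi) ≡ 0
  top = trans (cong (𝟙 (lo ≤? m) *_) (𝟙-no (m ≤? hi) (λ m≤hi → <-irrefl refl (≤-<-trans m≤hi hi<m))))
              (*-zeroʳ (𝟙 (lo ≤? m)))

sumFin : ∀ {m} → (Fin m → ℕ) → ℕ
sumFin {zero}  f = 0
sumFin {suc m} f = f F.zero + sumFin (f ∘ F.suc)

sumFin-mono : ∀ {m} {f g : Fin m → ℕ} → (∀ i → f i ≤ g i) → sumFin f ≤ sumFin g
sumFin-mono {zero}  h = z≤n
sumFin-mono {suc m} h = +-mono-≤ (h F.zero) (sumFin-mono (h ∘ F.suc))

sumFin-cong : ∀ {m} {f g : Fin m → ℕ} → (∀ i → f i ≡ g i) → sumFin f ≡ sumFin g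
sumFin-cong h = ≤-antisym (sumFin-mono (λ i → ≤-reflexive (h i)))
                          (sumFin-mono (λ i → ≤-reflexive (sym (h i))))

sumFin-+ : ∀ {m} (f g : Fin m → ℕ) → sumFin (λ i → f i + g i) ≡ sumFin f + sumFin g
sumFin-+ {zero}  f g = refl
sumFin-+ {suc m} f g rewrite sumFin-+ (f ∘ F.suc) (g ∘ F.suc) =
  interchange (f F.zero) (g F.zero) (sumFin (f ∘ F.suc)) (sumFin (g ∘ F.suc))

sumFin-*ˡ : ∀ {m} c (f : Fin m → ℕ) → sumFin (λ i → c * f i) ≡ c * sumFin f
sumFin-*ˡ {zero}  c f = sym (*-zeroʳ c)
sumFin-*ˡ {suc m} c f rewrite sumFin-*ˡ c (f ∘ F.suc) = sym (*-distribˡ-+ c (f F.zero) (sumFin (f ∘ F.suc)))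

sumFin-const : ∀ {m} c → sumFin {m} (λ _ → c) ≡ m * c
sumFin-const {zero}  c = refl
sumFin-const {suc m} c rewrite sumFin-const {m} c = refl

sumFin-ones : ∀ {m} → sumFin {m} (λ _ → 1) ≡ m
sumFin-ones {m} = trans (sumFin-const {m} 1) (*-identityʳ m)

sumFin-zero : ∀ {m} → sumFin {m} (λ _ → 0) ≡ 0
sumFin-zero {m} = trans (sumFin-const {m} 0) (*-zeroʳ m)

sumFin-term : ∀ {m} (f : Fin m → ℕ) i → f i ≤ sumFin f
sumFin-term f F.zero    = m≤m+n _ _
sumFin-term f (F.suc i) = ≤-trans (sumFin-term (f ∘ F.suc) i) (m≤n+m _ (f F.zero))

sumFin-comm : ∀ {m k} (f : Fin m → Fin k → ℕ) →
              sumFin (λ i → sumFin (λ j → f i j)) ≡ sumFin (λ j → sumFin (λ i → f i j))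
sumFin-comm {zero}  {k} f = sym (sumFin-zero {k})
sumFin-comm {suc m} {k} f =
  trans (cong (sumFin (f F.zero) +_) (sumFin-comm (f ∘ F.suc)))
        (sym (sumFin-+ (f F.zero) (λ j → sumFin (λ i → f (F.suc i) j))))

sumTo-sumFin-comm : ∀ m {k} (f : Fin k → ℕ → ℕ) →
                    sumTo m (λ t → sumFin (λ i → f i t)) ≡ sumFin (λ i → sumTo m (f i))
sumTo-sumFin-comm zero    {k} f = sym (sumFin-zero {k})
sumTo-sumFin-comm (suc m)     f =
  trans (cong (_+ sumFin (λ i → f i m)) (sumTo-sumFin-comm m f))
        (sym (sumFin-+ (λ i → sumTo m (f i)) (λ i → f i m)))

sumFin-product : ∀ {m} (x y : Fin m → ℕ) → sumFin (λ i → sumFin (λ j → x i * y j)) ≡ sumFin x * sumFin y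
sumFin-product x y =
  trans (sumFin-cong (λ i → trans (sumFin-*ˡ (x i) y) (*-comm (x i) (sumFin y))))
        (trans (sumFin-*ˡ (sumFin y) x) (*-comm (sumFin y) (sumFin x)))

sumFin-𝟙< : ∀ m → sumFin {m} (λ i → sumFin {m} (λ j → 𝟙 (i F.<? j))) ≡ m C 2
sumFin-𝟙< zero    = refl
sumFin-𝟙< (suc m) =
  trans (cong₂ _+_ firstRow otherRows)
        (trans (cong (_+ (m C 2)) (sym (nC1≡n m))) (nCk+nC[k+1]≡[n+1]C[k+1] m 1))
  where
  firstRow : sumFin {suc m} (λ j → 𝟙 (F.zero {m} F.<? j)) ≡ m
  firstRow = trans (cong₂ _+_ (𝟙-no (F.zero {m} F.<? F.zero {m}) (λ ()))
                              (sumFin-cong {m} (λ j → 𝟙-yes (F.zero {m} F.<? F.suc j) (s≤s z≤n))))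
                   (sumFin-ones {m})
  otherRows : sumFin {m} (λ i → sumFin {suc m} (λ j → 𝟙 (F.suc i F.<? j))) ≡ m C 2
  otherRows =
    trans (sumFin-cong {m} (λ i → cong₂ _+_ (𝟙-no (F.suc i F.<? F.zero {m}) (λ ()))
            (sumFin-cong {m} (λ j → 𝟙-cong (F.suc i F.<? F.suc j) (i F.<? j) ≤-pred s≤s))))
          (sumFin-𝟙< m)

guarded : {P : Set} → Dec P → (P → ℕ) → ℕ
guarded (yes p) φ = φ p
guarded (no _)  φ = 0

guarded-mono : {P : Set} (d : Dec P) {φ ψ : P → ℕ} → (∀ p → φ p ≤ ψ p) → guarded d φ ≤ guarded d ψ
guarded-mono (yes p) h = h p
guarded-mono (no _)  h = z≤n

guarded-+ : {P : Set} (d : Dec P) (φ ψ : P → ℕ) → guarded d (λ p → φ p + ψ p) ≡ guarded d φ + guarded d ψ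
guarded-+ (yes p) φ ψ = refl
guarded-+ (no _)  φ ψ = refl

guarded-*ˡ : {P : Set} (d : Dec P) (c : ℕ) (φ : P → ℕ) → guarded d (λ p → c * φ p) ≡ c * guarded d φ
guarded-*ˡ (yes p) c φ = refl
guarded-*ˡ (no _)  c φ = sym (*-zeroʳ c)

guarded-sumTo : {P : Set} (d : Dec P) (m : ℕ) (φ : ℕ → P → ℕ) →
                sumTo m (λ t → guarded d (φ t)) ≡ guarded d (λ p → sumTo m (λ t → φ t p))
guarded-sumTo (yes p) m φ = refl
guarded-sumTo (no _)  m φ = sumTo-zero m _ (λ _ _ → refl)

guarded-const : {P : Set} (d : Dec P) (c : ℕ) → guarded d (λ _ → c) ≡ 𝟙 d * c
guarded-const (yes _) c = sym (+-identityʳ c)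
guarded-const (no _)  c = refl

guarded-term : {P : Set} (d : Dec P) (φ : P → ℕ) (p : P) → (∀ p p' → φ p ≡ φ p') → φ p ≤ guarded d φ
guarded-term (yes p') φ p irr = ≤-reflexive (irr p p')
guarded-term (no ¬p)  φ p irr = ⊥-elim (¬p p)

Pairwise : ℕ → Set
Pairwise m = (I J : Fin m) → I F.< J → ℕ

pairsFrom : ∀ {m} → Pairwise m → Fin m → ℕ
pairsFrom φ I = sumFin (λ J → guarded (I F.<? J) (φ I J))

sumPairs : ∀ {m} → Pairwise m → ℕ
sumPairs φ = sumFin (pairsFrom φ)

sumPairs-mono : ∀ {m} {φ ψ : Pairwise m} → (∀ I J p → φ I J p ≤ ψ I J p) → sumPairs φ ≤ sumPairs ψ
sumPairs-mono h = sumFin-mono (λ I → sumFin-mono (λ J → guarded-mono (I F.<? J) (h I J)))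

sumPairs-cong : ∀ {m} {φ ψ : Pairwise m} → (∀ I J p → φ I J p ≡ ψ I J p) → sumPairs φ ≡ sumPairs ψ
sumPairs-cong h = ≤-antisym (sumPairs-mono (λ I J p → ≤-reflexive (h I J p)))
                            (sumPairs-mono (λ I J p → ≤-reflexive (sym (h I J p))))

sumPairs-+ : ∀ {m} (φ ψ : Pairwise m) → sumPairs (λ I J p → φ I J p + ψ I J p) ≡ sumPairs φ + sumPairs ψ
sumPairs-+ φ ψ =
  trans (sumFin-cong (λ I → trans (sumFin-cong (λ J → guarded-+ (I F.<? J) (φ I J) (ψ I J)))
                                  (sumFin-+ (λ J → guarded (I F.<? J) (φ I J)) (λ J → guarded (I F.<? J) (ψ I J)))))
        (sumFin-+ (pairsFrom φ) (pairsFrom ψ))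

sumPairs-*ˡ : ∀ {m} c (φ : Pairwise m) → sumPairs (λ I J p → c * φ I J p) ≡ c * sumPairs φ
sumPairs-*ˡ c φ =
  trans (sumFin-cong (λ I → trans (sumFin-cong (λ J → guarded-*ˡ (I F.<? J) c (φ I J)))
                                  (sumFin-*ˡ c (λ J → guarded (I F.<? J) (φ I J)))))
        (sumFin-*ˡ c (pairsFrom φ))

sumTo-sumPairs-comm : ∀ {m} k (φ : ℕ → Pairwise m) →
                      sumTo k (λ t → sumPairs (φ t)) ≡ sumPairs (λ I J p → sumTo k (λ t → φ t I J p))
sumTo-sumPairs-comm k φ =
  trans (sumTo-sumFin-comm k (λ I t → pairsFrom (φ t) I))
        (sumFin-cong (λ I → trans (sumTo-sumFin-comm k (λ J t → guarded (I F.<? J) (φ t I J)))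
                                  (sumFin-cong (λ J → guarded-sumTo (I F.<? J) k (λ t → φ t I J)))))

sumPairs-term : ∀ {m} (φ : Pairwise m) I J p → φ I J p ≤ sumPairs φ
sumPairs-term φ I J p =
  ≤-trans (guarded-term (I F.<? J) (φ I J) p (λ p p' → cong (φ I J) (<-irrelevant p p')))
          (≤-trans (sumFin-term (λ J → guarded (I F.<? J) (φ I J)) J) (sumFin-term (pairsFrom φ) I))

sumPairs-ones : ∀ {m} → sumPairs {m} (λ _ _ _ → 1) ≡ m C 2
sumPairs-ones {m} =
  trans (sumFin-cong {m} (λ I → sumFin-cong {m} (λ J → trans (guarded-const (I F.<? J) 1) (*-identityʳ _))))
        (sumFin-𝟙< m)

sumPairs-symmetrise : ∀ {m} (x : Fin m → Fin m → ℕ) →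
                      sumPairs (λ I J _ → x I J + x J I) ≤ sumFin (λ I → sumFin (x I))
sumPairs-symmetrise x = begin
  sumPairs (λ I J _ → x I J + x J I)
    ≡⟨ sumFin-cong (λ I → sumFin-cong (λ J → guarded-const (I F.<? J) (x I J + x J I))) ⟩
  sumFin (λ I → sumFin (λ J → 𝟙 (I F.<? J) * (x I J + x J I)))
    ≡⟨ sumFin-cong (λ I → trans (sumFin-cong (λ J → *-distribˡ-+ (𝟙 (I F.<? J)) (x I J) (x J I)))
                                (sumFin-+ (λ J → 𝟙 (I F.<? J) * x I J) (λ J → 𝟙 (I F.<? J) * x J I))) ⟩
  sumFin (λ I → sumFin (λ J → 𝟙 (I F.<? J) * x I J) + sumFin (λ J → 𝟙 (I F.<? J) * x J I))
    ≡⟨ sumFin-+ (λ I → sumFin (λ J → 𝟙 (I F.<? J) * x I J)) (λ I → sumFin (λ J → 𝟙 (I F.<? J) * x J I)) ⟩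
  sumFin (λ I → sumFin (λ J → 𝟙 (I F.<? J) * x I J)) + sumFin (λ I → sumFin (λ J → 𝟙 (I F.<? J) * x J I))
    ≡⟨ cong (sumFin (λ I → sumFin (λ J → 𝟙 (I F.<? J) * x I J)) +_) (sumFin-comm (λ I J → 𝟙 (I F.<? J) * x J I)) ⟩
  sumFin (λ I → sumFin (λ J → 𝟙 (I F.<? J) * x I J)) + sumFin (λ I → sumFin (λ J → 𝟙 (J F.<? I) * x I J))
    ≡⟨ sym (sumFin-+ (λ I → sumFin (λ J → 𝟙 (I F.<? J) * x I J)) (λ I → sumFin (λ J → 𝟙 (J F.<? I) * x I J))) ⟩
  sumFin (λ I → sumFin (λ J → 𝟙 (I F.<? J) * x I J) + sumFin (λ J → 𝟙 (J F.<? I) * x I J))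
    ≡⟨ sumFin-cong (λ I → sym (sumFin-+ (λ J → 𝟙 (I F.<? J) * x I J) (λ J → 𝟙 (J F.<? I) * x I J))) ⟩
  sumFin (λ I → sumFin (λ J → 𝟙 (I F.<? J) * x I J + 𝟙 (J F.<? I) * x I J))
    ≤⟨ sumFin-mono (λ I → sumFin-mono (λ J → at-most-once I J)) ⟩
  sumFin (λ I → sumFin (x I)) ∎
  where
  open ≤-Reasoning
  at-most-once : ∀ I J → 𝟙 (I F.<? J) * x I J + 𝟙 (J F.<? I) * x I J ≤ x I J
  at-most-once I J = begin
    𝟙 (I F.<? J) * x I J + 𝟙 (J F.<? I) * x I J ≡⟨ sym (*-distribʳ-+ (x I J) (𝟙 (I F.<? J)) (𝟙 (J F.<? I))) ⟩
    (𝟙 (I F.<? J) + 𝟙 (J F.<? I)) * x I J       ≤⟨ *-monoˡ-≤ (x I J) (𝟙-exclusive (I F.<? J) (J F.<? I) <-asym) ⟩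
    1 * x I J                                   ≡⟨ *-identityˡ (x I J) ⟩
    x I J                                       ∎

-- Points of a line separated by a given point

openInterval : ℕ → ℕ → ℕ → ℕ
openInterval a b t = 𝟙 (a ⊓ b <? t) * 𝟙 (t <? a ⊔ b)

closedInterval : ℕ → ℕ → ℕ → ℕ
closedInterval a b t = 𝟙 (a ⊓ b ≤? t) * 𝟙 (t ≤? a ⊔ b)

4xy≤[x+y]² : ∀ x y → 4 * (x * y) ≤ (x + y) * (x + y)
4xy≤[x+y]² x y with ≤-total x y
... | inj₁ x≤y with m≤n⇒∃[o]m+o≡n x≤y
...   | d , refl = ≤-trans (m≤m+n _ (d * d)) (≤-reflexive (identity x d))
  where
  identity : ∀ x d → 4 * (x * (x + d)) + d * d ≡ (x + (x + d)) * (x + (x + d))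
  identity = solve-∀
4xy≤[x+y]² x y | inj₂ y≤x with m≤n⇒∃[o]m+o≡n y≤x
...   | d , refl = ≤-trans (m≤m+n _ (d * d)) (≤-reflexive (identity y d))
  where
  identity : ∀ y d → 4 * ((y + d) * y) + d * d ≡ (y + d + y) * (y + d + y)
  identity = solve-∀

module Separation {m : ℕ} (ρ : Fin m → ℕ) (t : ℕ) where

  below : Fin m → ℕ
  below I = 𝟙 (ρ I <? t)

  above : Fin m → ℕ
  above I = 𝟙 (t <? ρ I)

  openInterval≤ : ∀ a b → openInterval a b t ≤ 𝟙 (a <? t) * 𝟙 (t <? b) + 𝟙 (b <? t) * 𝟙 (t <? a)
  openInterval≤ a b with ≤-total a b
  ... | inj₁ a≤b rewrite m≤n⇒m⊓n≡m a≤b | m≤n⇒m⊔n≡n a≤b = m≤m+n _ _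
  ... | inj₂ b≤a rewrite m≥n⇒m⊓n≡n b≤a | m≥n⇒m⊔n≡m b≤a = m≤n+m _ _

  separated≤below*above : sumPairs (λ I J _ → openInterval (ρ I) (ρ J) t) ≤ sumFin below * sumFin above
  separated≤below*above = begin
    sumPairs (λ I J _ → openInterval (ρ I) (ρ J) t)
      ≤⟨ sumPairs-mono (λ I J _ → openInterval≤ (ρ I) (ρ J)) ⟩
    sumPairs (λ I J _ → below I * above J + below J * above I)
      ≤⟨ sumPairs-symmetrise (λ I J → below I * above J) ⟩
    sumFin (λ I → sumFin (λ J → below I * above J))
      ≡⟨ sumFin-product below above ⟩
    sumFin below * sumFin above ∎
    where open ≤-Reasoning

  below+above≤m : sumFin below + sumFin above ≤ m
  below+above≤m = begin
    sumFin below + sumFin above         ≡⟨ sym (sumFin-+ below above) ⟩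
    sumFin (λ I → below I + above I)    ≤⟨ sumFin-mono (λ I → 𝟙-exclusive (ρ I <? t) (t <? ρ I) <-asym) ⟩
    sumFin {m} (λ _ → 1)                ≡⟨ sumFin-ones ⟩
    m                                   ∎
    where open ≤-Reasoning

  separated< : ∀ {N} → m * m < 4 * N → sumPairs (λ I J _ → openInterval (ρ I) (ρ J) t) < N
  separated< m²<4N = ≤-<-trans separated≤below*above
    (*-cancelˡ-< 4 _ _ (≤-<-trans (4xy≤[x+y]² (sumFin below) (sumFin above))
                         (≤-<-trans (*-mono-≤ below+above≤m below+above≤m) m²<4N)))

forward-length : ∀ R i p c → i ≤ p → p ≤ c → (p ∸ i) + (R + (c ∸ p)) ≡ R + (c ∸ i)
forward-length R i p c i≤p p≤c with m≤n⇒∃[o]m+o≡n i≤p | m≤n⇒∃[o]m+o≡n p≤c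
... | d₁ , refl | d₂ , refl = begin
  (i + d₁ ∸ i) + (R + (i + d₁ + d₂ ∸ (i + d₁)))
    ≡⟨ cong₂ (λ a b → a + (R + b)) (m+n∸m≡n i d₁) (m+n∸m≡n (i + d₁) d₂) ⟩
  d₁ + (R + d₂)
    ≡⟨ lemma d₁ d₂ R ⟩
  R + (d₁ + d₂)
    ≡⟨ cong (R +_) (sym (trans (cong (_∸ i) (+-assoc i d₁ d₂)) (m+n∸m≡n i (d₁ + d₂)))) ⟩
  R + (i + d₁ + d₂ ∸ i) ∎
  where
  open ≡-Reasoning
  lemma : ∀ d₁ d₂ R → d₁ + (R + d₂) ≡ R + (d₁ + d₂)
  lemma = solve-∀

backward-length : ∀ R i c p n → i < c → c ≤ p → p < n →
             i + suc ((n ∸ 1 ∸ p) + (R + (p ∸ c))) ≡ R + (n ∸ (c ∸ i))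
backward-length R i _ _ _ i<c c≤p p<n with m≤n⇒∃[o]m+o≡n i<c | m≤n⇒∃[o]m+o≡n c≤p | m≤n⇒∃[o]m+o≡n p<n
... | d₁ , refl | d₂ , refl | d₃ , refl = begin
  i + suc ((p + d₃ ∸ p) + (R + (p ∸ c)))
    ≡⟨ cong₂ (λ a b → i + suc (a + (R + b))) (m+n∸m≡n p d₃) (m+n∸m≡n c d₂) ⟩
  i + suc (d₃ + (R + d₂))
    ≡⟨ lemma i d₂ d₃ R ⟩
  R + (i + suc (d₂ + d₃))
    ≡⟨ cong (R +_) (sym (m+n∸n≡m _ (suc d₁))) ⟩
  R + (i + suc (d₂ + d₃) + suc d₁ ∸ suc d₁)
    ≡⟨ cong₂ (λ a b → R + (a ∸ b)) (sym (n≡ i d₁ d₂ d₃)) c∸i≡ ⟩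
  R + (suc p + d₃ ∸ (c ∸ i)) ∎
  where
  open ≡-Reasoning
  c = suc i + d₁
  p = c + d₂
  c∸i≡ : suc d₁ ≡ c ∸ i
  c∸i≡ = sym (trans (cong (_∸ i) (sym (+-suc i d₁))) (m+n∸m≡n i (suc d₁)))
  n≡ : ∀ i d₁ d₂ d₃ → suc (suc i + d₁ + d₂ + d₃) ≡ i + suc (d₂ + d₃) + suc d₁
  n≡ = solve-∀
  lemma : ∀ i d₂ d₃ R → i + suc (d₃ + (R + d₂)) ≡ R + (i + suc (d₂ + d₃))
  lemma = solve-∀

-- The grid P_r □ C_n

∣n-1+n∣≡1 : ∀ a → ∣ a - suc a ∣ ≡ 1
∣n-1+n∣≡1 zero    = refl
∣n-1+n∣≡1 (suc a) = ∣n-1+n∣≡1 a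

∣1+n-n∣≡1 : ∀ a → ∣ suc a - a ∣ ≡ 1
∣1+n-n∣≡1 zero    = refl
∣1+n-n∣≡1 (suc a) = ∣1+n-n∣≡1 a

∣-∣-adjacent : ∀ a a' b → (suc a ≡ a') ⊎ (suc a' ≡ a) → ∣ a - b ∣ ≤ suc ∣ a' - b ∣
∣-∣-adjacent a a' b adj = ≤-trans (∣-∣-triangle a a' b) (+-monoˡ-≤ _ (∣a-a'∣≤1 adj))
  where
  ∣a-a'∣≤1 : (suc a ≡ a') ⊎ (suc a' ≡ a) → ∣ a - a' ∣ ≤ 1
  ∣a-a'∣≤1 (inj₁ refl) = ≤-reflexive (∣n-1+n∣≡1 a)
  ∣a-a'∣≤1 (inj₂ refl) = ≤-reflexive (∣1+n-n∣≡1 a')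

∣m-n∣+n≡m : ∀ {m n} → n ≤ m → ∣ m - n ∣ + n ≡ m
∣m-n∣+n≡m n≤m = trans (cong (_+ _) (m≤n⇒∣n-m∣≡n∸m n≤m)) (m∸n+n≡m n≤m)

n∸[c∸i]≤c∸i : ∀ {i c n f} → i ≤ c → i + n ≤ c + f → f + f ≤ n → n ∸ (c ∸ i) ≤ c ∸ i
n∸[c∸i]≤c∸i {i} {c} {n} {f} i≤c long f+f≤n =
  ≤-trans (m≤n+o⇒m∸n≤o n d n≤d+f) (+-cancelʳ-≤ f f d (≤-trans f+f≤n n≤d+f))
  where
  d = c ∸ i
  n≤d+f : n ≤ d + f
  n≤d+f = +-cancelˡ-≤ i n (d + f)
            (≤-trans long (≤-reflexive (trans (cong (_+ f) (sym (m+[n∸m]≡n i≤c))) (+-assoc i d f))))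

m∸n≤1+[m∸1+n] : ∀ m d → m ∸ d ≤ suc (m ∸ suc d)
m∸n≤1+[m∸1+n] zero    zero    = z≤n
m∸n≤1+[m∸1+n] zero    (suc d) = z≤n
m∸n≤1+[m∸1+n] (suc m) zero    = ≤-refl
m∸n≤1+[m∸1+n] (suc m) (suc d) = m∸n≤1+[m∸1+n] m d

module Grid (r n : ℕ) where

  V : Set
  V = Fin r × Fin n

  E : V → V → Set
  E = Box (PathAdj r) (CycleAdj n)

  row : V → ℕ
  row u = toℕ (proj₁ u)

  col : V → ℕ
  col u = toℕ (proj₂ u)

  cycleDist : ℕ → ℕ → ℕ
  cycleDist x y = ∣ x - y ∣ ⊓ (n ∸ ∣ x - y ∣)

  dist : V → V → ℕ
  dist u v = ∣ row u - row v ∣ + cycleDist (col u) (col v)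

  1+[n∸1]≡n : ∀ {y} → y < n → suc (n ∸ 1) ≡ n
  1+[n∸1]≡n (s≤s _) = refl

  ⊓-step : ∀ d d' → (d ≤ suc d' × d' ≤ suc d) ⊎ (suc (d + d') ≡ n) →
           d ⊓ (n ∸ d) ≤ suc (d' ⊓ (n ∸ d'))
  ⊓-step d d' h = ≤-trans (bound h) (≤-reflexive (sym (+-distribˡ-⊓ 1 d' (n ∸ d'))))
    where
    bound : (d ≤ suc d' × d' ≤ suc d) ⊎ (suc (d + d') ≡ n) → d ⊓ (n ∸ d) ≤ suc d' ⊓ suc (n ∸ d')
    bound (inj₁ (d≤ , d'≤)) = ⊓-mono-≤ d≤ (≤-trans (m∸n≤1+[m∸1+n] n d) (s≤s (∸-monoʳ-≤ n d'≤)))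
    bound (inj₂ e) = ⊓-glb (≤-trans (m⊓n≤n d (n ∸ d)) (≤-reflexive n∸d≡1+d'))
                           (≤-trans (m⊓n≤m d (n ∸ d)) (≤-trans (n≤1+n d) (≤-trans (n≤1+n (suc d))
                                                                                   (≤-reflexive (cong suc 1+d≡n∸d')))))
      where
      n∸d≡1+d' : n ∸ d ≡ suc d'
      n∸d≡1+d' = trans (cong (_∸ d) (trans (sym e) (sym (+-suc d d')))) (m+n∸m≡n d (suc d'))
      1+d≡n∸d' : suc d ≡ n ∸ d'
      1+d≡n∸d' = trans (sym (m+n∸n≡m (suc d) d')) (cong (_∸ d') e)

  cycleDist-step : ∀ x x' y → y < n → CycleAdj n x x' →
                   cycleDist (toℕ x) y ≤ suc (cycleDist (toℕ x') y)
  cycleDist-step x x' y y<n (inj₁ e) =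
    ⊓-step _ _ (inj₁ (∣-∣-adjacent _ _ y (inj₁ e) , ∣-∣-adjacent _ _ y (inj₂ e)))
  cycleDist-step x x' y y<n (inj₂ (inj₁ e)) =
    ⊓-step _ _ (inj₁ (∣-∣-adjacent _ _ y (inj₂ e) , ∣-∣-adjacent _ _ y (inj₁ e)))
  cycleDist-step x x' y y<n (inj₂ (inj₂ (inj₁ (e , x'≡0)))) rewrite x'≡0 =
    ⊓-step _ _ (inj₂ (trans (cong suc (∣m-n∣+n≡m (≤-pred (≤-trans y<n (≤-reflexive (sym e)))))) e))
  cycleDist-step x x' y y<n (inj₂ (inj₂ (inj₂ (e , x≡0)))) rewrite x≡0 =
    ⊓-step _ _ (inj₂ (trans (cong suc (trans (+-comm y ∣ toℕ x' - y ∣)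
                                             (∣m-n∣+n≡m (≤-pred (≤-trans y<n (≤-reflexive (sym e)))))))
                            e))

  dist-step : ∀ {u u'} (v : V) → E u u' → dist u v ≤ suc (dist u' v)
  dist-step {g , h} {g' , h'} v (inj₁ (refl , c)) =
    ≤-trans (+-monoʳ-≤ ∣ toℕ g - row v ∣ (cycleDist-step h h' (col v) (toℕ<n (proj₂ v)) c))
            (≤-reflexive (+-suc _ _))
  dist-step {g , h} {g' , h'} v (inj₂ (refl , p)) =
    +-monoˡ-≤ (cycleDist (toℕ h) (col v)) (∣-∣-adjacent (toℕ g) (toℕ g') (row v) p)

  dist-refl : ∀ v → dist v v ≡ 0
  dist-refl v rewrite m≡n⇒∣m-n∣≡0 {row v} refl | m≡n⇒∣m-n∣≡0 {col v} refl = refl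

  dist≤length : ∀ {u v k} → Walk E u v k → dist u v ≤ k
  dist≤length {v = v} here       = ≤-reflexive (dist-refl v)
  dist≤length {v = v} (step e w) = ≤-trans (dist-step v e) (s≤s (dist≤length w))

  cycleDist≤⌊n/2⌋ : ∀ x y → cycleDist x y ≤ n / 2
  cycleDist≤⌊n/2⌋ x y = ≤-trans (≤-reflexive (sym (m*n/n≡m c 2)))
                                (/-monoˡ-≤ 2 (≤-trans (≤-reflexive c*2≡c+c) c+c≤n))
    where
    d = ∣ x - y ∣
    c = cycleDist x y
    c*2≡c+c : c * 2 ≡ c + c
    c*2≡c+c = trans (*-comm c 2) (cong (c +_) (+-identityʳ c))
    c+c≤n : c + c ≤ n
    c+c≤n with d ≤? n
    ... | yes d≤n = ≤-trans (+-mono-≤ (m⊓n≤m d (n ∸ d)) (m⊓n≤n d (n ∸ d))) (≤-reflexive (m+[n∸m]≡n d≤n))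
    ... | no d≰n  = ≤-trans (≤-reflexive (cong (λ z → z + z) (trans (cong (d ⊓_) (m≤n⇒m∸n≡0 (<⇒≤ (≰⇒> d≰n))))
                                                                    (⊓-zeroʳ d))))
                            z≤n

  cycleDist-forward : ∀ {i c} → i ≤ c → c ∸ i ≤ n ∸ (c ∸ i) → cycleDist i c ≡ c ∸ i
  cycleDist-forward {i} {c} i≤c short rewrite ∣-∣-comm i c | m≤n⇒∣n-m∣≡n∸m i≤c = m≤n⇒m⊓n≡m short

  cycleDist-backward : ∀ {i c} → i ≤ c → n ∸ (c ∸ i) ≤ c ∸ i → cycleDist i c ≡ n ∸ (c ∸ i)
  cycleDist-backward {i} {c} i≤c long rewrite ∣-∣-comm i c | m≤n⇒∣n-m∣≡n∸m i≤c = m≥n⇒m⊓n≡n long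

  vertex-≡ : ∀ {a b : V} → row a ≡ row b → col a ≡ col b → a ≡ b
  vertex-≡ e₁ e₂ = cong₂ _,_ (toℕ-injective e₁) (toℕ-injective e₂)

  E-sym : ∀ {a b : V} → E a b → E b a
  E-sym (inj₁ (refl , inj₁ e))                = inj₁ (refl , inj₂ (inj₁ e))
  E-sym (inj₁ (refl , inj₂ (inj₁ e)))         = inj₁ (refl , inj₁ e)
  E-sym (inj₁ (refl , inj₂ (inj₂ (inj₁ p))))  = inj₁ (refl , inj₂ (inj₂ (inj₂ p)))
  E-sym (inj₁ (refl , inj₂ (inj₂ (inj₂ p))))  = inj₁ (refl , inj₂ (inj₂ (inj₁ p)))
  E-sym (inj₂ (refl , inj₁ e))                = inj₂ (refl , inj₂ e)
  E-sym (inj₂ (refl , inj₂ e))                = inj₂ (refl , inj₁ e)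

  _++ʷ_ : ∀ {a b c : V} {k m} → Walk E a b k → Walk E b c m → Walk E a c (k + m)
  here       ++ʷ w₂ = w₂
  step e w₁ ++ʷ w₂ = step e (w₁ ++ʷ w₂)

  onWalk-start : ∀ {b c : V} {m} (w : Walk E b c m) → OnWalk b w
  onWalk-start here       = on-here
  onWalk-start (step e w) = on-start e w

  onWalk-++ˡ : ∀ {a b c : V} {k m} (w₁ : Walk E a b k) (w₂ : Walk E b c m) {x : V} →
               OnWalk x w₁ → OnWalk x (w₁ ++ʷ w₂)
  onWalk-++ˡ .here       w₂ on-here        = onWalk-start w₂
  onWalk-++ˡ (step e w₁) w₂ (on-start e w₁) = on-start e (w₁ ++ʷ w₂)
  onWalk-++ˡ (step e w₁) w₂ (on-later e o)  = on-later e (onWalk-++ˡ w₁ w₂ o)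

  onWalk-++ʳ : ∀ {a b c : V} {k m} (w₁ : Walk E a b k) {w₂ : Walk E b c m} {x : V} →
               OnWalk x w₂ → OnWalk x (w₁ ++ʷ w₂)
  onWalk-++ʳ here        o = o
  onWalk-++ʳ (step e w₁) o = on-later e (onWalk-++ʳ w₁ o)

  reverse : ∀ {a b : V} {k} → Walk E a b k → Walk E b a k
  reverse {k = k} w = subst (Walk E _ _) (+-identityʳ k) (go w here)
    where
    go : ∀ {a b c : V} {k m} → Walk E a b k → Walk E a c m → Walk E b c (k + m)
    go here       acc = acc
    go {k = suc k} {m} (step e w) acc = subst (Walk E _ _) (+-suc k m) (go w (step (E-sym e) acc))

  walk₀ : ∀ {a b : V} → a ≡ b → Walk E a b 0
  walk₀ refl = here

  onWalk₀ : ∀ {a b : V} (e : a ≡ b) → OnWalk a (walk₀ e)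
  onWalk₀ refl = on-here

  1+x≤x+1+u : ∀ x u → suc x ≤ x + suc u
  1+x≤x+1+u x u = ≤-trans (s≤s (m≤m+n x u)) (≤-reflexive (sym (+-suc x u)))

  cycleWalk : ∀ u (a b : V) → proj₁ a ≡ proj₁ b → col a + u ≡ col b → Walk E a b u
  cycleWalk zero    a b e₁ e₂ = walk₀ (vertex-≡ (cong toℕ e₁) (trans (sym (+-identityʳ _)) e₂))
  cycleWalk (suc u) a b e₁ e₂ = step edge (cycleWalk u c b e₁ e₂')
    where
    lt : suc (col a) < n
    lt = ≤-trans (s≤s (≤-trans (1+x≤x+1+u (col a) u) (≤-reflexive e₂))) (toℕ<n (proj₂ b))
    c : V
    c = proj₁ a , fromℕ< lt
    edge : E a c
    edge = inj₁ (refl , inj₁ (sym (toℕ-fromℕ< lt)))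
    e₂' : col c + u ≡ col b
    e₂' = trans (cong (_+ u) (toℕ-fromℕ< lt)) (trans (sym (+-suc (col a) u)) e₂)

  pathWalk : ∀ u (a b : V) → proj₂ a ≡ proj₂ b → row a + u ≡ row b → Walk E a b u
  pathWalk zero    a b e₁ e₂ = walk₀ (vertex-≡ (trans (sym (+-identityʳ _)) e₂) (cong toℕ e₁))
  pathWalk (suc u) a b e₁ e₂ = step edge (pathWalk u c b e₁ e₂')
    where
    lt : suc (row a) < r
    lt = ≤-trans (s≤s (≤-trans (1+x≤x+1+u (row a) u) (≤-reflexive e₂))) (toℕ<n (proj₁ b))
    c : V
    c = fromℕ< lt , proj₂ a
    edge : E a c
    edge = inj₂ (refl , inj₁ (sym (toℕ-fromℕ< lt)))
    e₂' : row c + u ≡ row b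
    e₂' = trans (cong (_+ u) (toℕ-fromℕ< lt)) (trans (sym (+-suc (row a) u)) e₂)

  onPathWalk : ∀ u (a b : V) e₁ e₂ (c : V) → proj₂ c ≡ proj₂ a → row a ≤ row c → row c ≤ row a + u →
               OnWalk c (pathWalk u a b e₁ e₂)
  onPathWalk zero a b e₁ e₂ c ec a≤c c≤a
    with vertex-≡ {c} {a} (≤-antisym (≤-trans c≤a (≤-reflexive (+-identityʳ _))) a≤c) (cong toℕ ec)
  ... | refl = onWalk₀ _
  onPathWalk (suc u) a b e₁ e₂ c ec a≤c c≤a+u with row a ≟ row c
  ... | yes a≡c with vertex-≡ {c} {a} (sym a≡c) (cong toℕ ec)
  ...   | refl = on-start _ _
  onPathWalk (suc u) a b e₁ e₂ c ec a≤c c≤a+u | no a≢c = on-later _ (onPathWalk u _ b e₁ _ c ec a'≤c c≤a'+u)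
    where
    lt : suc (row a) < r
    lt = ≤-trans (s≤s (≤-trans (1+x≤x+1+u (row a) u) (≤-reflexive e₂))) (toℕ<n (proj₁ b))
    a'≤c : toℕ (fromℕ< lt) ≤ row c
    a'≤c = ≤-trans (≤-reflexive (toℕ-fromℕ< lt)) (≤∧≢⇒< a≤c a≢c)
    c≤a'+u : row c ≤ toℕ (fromℕ< lt) + u
    c≤a'+u = ≤-trans c≤a+u (≤-reflexive (trans (+-suc (row a) u) (cong (_+ u) (sym (toℕ-fromℕ< lt)))))

  cycleWalk⁻ : ∀ u (a b : V) → proj₁ a ≡ proj₁ b → col b + u ≡ col a → Walk E a b u
  cycleWalk⁻ u a b e₁ e₂ = reverse (cycleWalk u b a (sym e₁) e₂)

  pathWalk⁻ : ∀ u (a b : V) → proj₂ a ≡ proj₂ b → row b + u ≡ row a → Walk E a b u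
  pathWalk⁻ u a b e₁ e₂ = reverse (pathWalk u b a (sym e₁) e₂)

  module _ {y : ℕ} (y<n : y < n) where

    0<n : 0 < n
    0<n = ≤-<-trans z≤n y<n

    n∸1<n : n ∸ 1 < n
    n∸1<n = ≤-reflexive (1+[n∸1]≡n y<n)

    wrapEdge : ∀ ℓ → E (ℓ , fromℕ< 0<n) (ℓ , fromℕ< n∸1<n)
    wrapEdge ℓ = inj₁ (refl , inj₂ (inj₂ (inj₂ (trans (cong suc (toℕ-fromℕ< n∸1<n)) (1+[n∸1]≡n y<n) ,
                                                toℕ-fromℕ< 0<n))))

  ∸-wrap : ∀ m x y → x ≤ y → y ≤ m → x + suc (m ∸ y) ≡ suc m ∸ (y ∸ x)
  ∸-wrap m x y x≤y y≤m = trans (+-suc x (m ∸ y)) (trans (cong suc (sym (go m x y x≤y y≤m)))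
                                                        (sym (+-∸-assoc 1 (≤-trans (m∸n≤m y x) y≤m))))
    where
    go : ∀ m x y → x ≤ y → y ≤ m → m ∸ (y ∸ x) ≡ x + (m ∸ y)
    go m zero y _ _ = refl
    go (suc m) (suc x) (suc y) (s≤s x≤y) (s≤s y≤m) =
      trans (+-∸-assoc 1 (≤-trans (m∸n≤m y x) y≤m)) (cong suc (go m x y x≤y y≤m))

  rowWalk≤ : (ℓ : Fin r) (x y : Fin n) → toℕ x ≤ toℕ y →
             Σ ℕ λ k → Walk E (ℓ , x) (ℓ , y) k × k ≤ cycleDist (toℕ x) (toℕ y)
  rowWalk≤ ℓ x y x≤y with (toℕ y ∸ toℕ x) ≤? (n ∸ (toℕ y ∸ toℕ x))
  ... | yes short = toℕ y ∸ toℕ x , cycleWalk _ _ _ refl (m+[n∸m]≡n x≤y) ,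
                    ≤-reflexive (sym (cycleDist-forward x≤y short))
  ... | no ¬short = toℕ x + suc ((n ∸ 1) ∸ toℕ y) , w ,
                    ≤-reflexive (trans length≡ (sym (cycleDist-backward x≤y (<⇒≤ (≰⇒> ¬short)))))
    where
    y<n = toℕ<n y
    y≤n∸1 : toℕ y ≤ n ∸ 1
    y≤n∸1 = <⇒≤pred y<n
    w : Walk E (ℓ , x) (ℓ , y) (toℕ x + suc ((n ∸ 1) ∸ toℕ y))
    w = cycleWalk⁻ (toℕ x) (ℓ , x) (ℓ , fromℕ< (0<n y<n)) refl (cong (_+ toℕ x) (toℕ-fromℕ< (0<n y<n)))
        ++ʷ step (wrapEdge y<n ℓ)
                 (cycleWalk⁻ _ (ℓ , fromℕ< (n∸1<n y<n)) (ℓ , y) refl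
                             (trans (m+[n∸m]≡n y≤n∸1) (sym (toℕ-fromℕ< (n∸1<n y<n)))))
    length≡ : toℕ x + suc ((n ∸ 1) ∸ toℕ y) ≡ n ∸ (toℕ y ∸ toℕ x)
    length≡ = trans (∸-wrap (n ∸ 1) (toℕ x) (toℕ y) x≤y y≤n∸1) (cong (_∸ (toℕ y ∸ toℕ x)) (1+[n∸1]≡n y<n))

  rowWalk : (ℓ : Fin r) (x y : Fin n) → Σ ℕ λ k → Walk E (ℓ , x) (ℓ , y) k × k ≤ cycleDist (toℕ x) (toℕ y)
  rowWalk ℓ x y with toℕ x ≤? toℕ y
  ... | yes x≤y = rowWalk≤ ℓ x y x≤y
  ... | no x≰y with rowWalk≤ ℓ y x (<⇒≤ (≰⇒> x≰y))
  ...   | k , w , k≤ = k , reverse w ,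
                       ≤-trans k≤ (≤-reflexive (cong (λ d → d ⊓ (n ∸ d)) (∣-∣-comm (toℕ y) (toℕ x))))

  columnWalk : (ℓ ℓ' : Fin r) (y : Fin n) → Walk E (ℓ , y) (ℓ' , y) ∣ toℕ ℓ - toℕ ℓ' ∣
  columnWalk ℓ ℓ' y with toℕ ℓ ≤? toℕ ℓ'
  ... | yes ℓ≤ℓ' = subst (Walk E _ _) (sym (trans (∣-∣-comm (toℕ ℓ) (toℕ ℓ')) (m≤n⇒∣n-m∣≡n∸m ℓ≤ℓ')))
                         (pathWalk _ _ _ refl (m+[n∸m]≡n ℓ≤ℓ'))
  ... | no ℓ≰ℓ' = subst (Walk E _ _) (sym (m≤n⇒∣n-m∣≡n∸m ℓ'≤ℓ)) (pathWalk⁻ _ _ _ refl (m+[n∸m]≡n ℓ'≤ℓ))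
    where
    ℓ'≤ℓ = <⇒≤ (≰⇒> ℓ≰ℓ')

  walk≤dist : (u v : V) → Σ ℕ λ k → Walk E u v k × k ≤ dist u v
  walk≤dist (ℓ , x) (ℓ' , y) with rowWalk ℓ x y
  ... | k , w , k≤ = k + ∣ toℕ ℓ - toℕ ℓ' ∣ , w ++ʷ columnWalk ℓ ℓ' y ,
                     ≤-trans (+-monoˡ-≤ _ k≤) (≤-reflexive (+-comm (cycleDist (toℕ x) (toℕ y)) _))

  geodesic : ∀ {u v : V} {k} → Walk E u v k → k ≤ dist u v → Geodesic E u v
  geodesic {k = k} w k≤ = record { len = k ; walk = w ; minimal = λ w' → ≤-trans k≤ (dist≤length w') }

  someGeodesic : (u v : V) → Geodesic E u v
  someGeodesic u v with walk≤dist u v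
  ... | k , w , k≤ = geodesic w k≤

  geodesic-len≤dist : ∀ {u v : V} (g : Geodesic E u v) → Geodesic.len g ≤ dist u v
  geodesic-len≤dist {u} {v} g = ≤-trans (Geodesic.minimal g (proj₁ (proj₂ (walk≤dist u v))))
                                        (proj₂ (proj₂ (walk≤dist u v)))

  strongGeodetic-applyUpTo :
    (m : ℕ) (f : ℕ → V) (G : (i j : ℕ) → Geodesic E (f i) (f j)) →
    (∀ v → Σ ℕ λ i → Σ ℕ λ j → i < j × j < m × OnGeodesic v (G i j)) →
    StrongGeodetic E (applyUpTo f m)
  strongGeodetic-applyUpTo m f G cover = G' , cover'
    where
    S = applyUpTo f m
    lookup≡ : ∀ I → lookup S I ≡ f (toℕ I)
    lookup≡ = lookup-applyUpTo f m
    G' : (I J : Fin (length S)) → I F.< J → Geodesic E (lookup S I) (lookup S J)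
    G' I J _ = subst₂ (Geodesic E) (sym (lookup≡ I)) (sym (lookup≡ J)) (G (toℕ I) (toℕ J))
    onGeodesic-subst : ∀ {u u' w w' v : V} (e₁ : u ≡ u') (e₂ : w ≡ w') (g : Geodesic E u w) →
                       OnGeodesic v g → OnGeodesic v (subst₂ (Geodesic E) e₁ e₂ g)
    onGeodesic-subst refl refl g o = o
    index : ∀ {i} → i < m → Fin (length S)
    index i<m = fromℕ< (≤-trans i<m (≤-reflexive (sym (length-applyUpTo f m))))
    toℕ-index : ∀ {i} (i<m : i < m) → toℕ (index i<m) ≡ i
    toℕ-index i<m = toℕ-fromℕ< (≤-trans i<m (≤-reflexive (sym (length-applyUpTo f m))))
    cover' : (v : V) → ∃[ I ] ∃[ J ] Σ (I F.< J) λ p → OnGeodesic v (G' I J p)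
    cover' v with cover v
    ... | i , j , i<j , j<m , o = index i<m , index j<m ,
                                  subst₂ _<_ (sym (toℕ-index i<m)) (sym (toℕ-index j<m)) i<j ,
                                  onGeodesic-subst _ _ (G (toℕ (index i<m)) (toℕ (index j<m))) o'
      where
      i<m = <-trans i<j j<m
      o' : OnGeodesic v (G (toℕ (index i<m)) (toℕ (index j<m)))
      o' rewrite toℕ-index i<m | toℕ-index j<m = o

  ThroughColumn : V → V → ℕ → Set
  ThroughColumn x y p = Σ ℕ λ k → Σ (Walk E x y k) λ w → k ≤ dist x y × (∀ v → col v ≡ p → OnWalk v w)

  throughColumn-geodesic : ∀ {x y p} → ThroughColumn x y p → Geodesic E x y
  throughColumn-geodesic (k , w , k≤ , _) = geodesic w k≤

  onGeodesic-throughColumn : ∀ {x y p} (T : ThroughColumn x y p) v → col v ≡ p →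
                             OnGeodesic v (throughColumn-geodesic T)
  onGeodesic-throughColumn (k , w , k≤ , cover) = cover

  -- From x = (0, i) to y = (r - 1, c) through all of column p: forward, along row 0 up to p, down
  -- column p and on to c; or backward, from i down to column 0, over the wrap edge to n - 1, on to p,
  -- down column p and back to c.
  module TopToBottom (x y : V) {i c : ℕ} (row-x : row x ≡ 0) (col-x : col x ≡ i)
                     (row-y : row y ≡ r ∸ 1) (col-y : col y ≡ c) where

    dist≡ : dist x y ≡ (r ∸ 1) + cycleDist i c
    dist≡ rewrite row-x | row-y | col-x | col-y = refl

    columnWalk-top-bottom : ∀ {p} (p<n : p < n) → Walk E (proj₁ x , fromℕ< p<n) (proj₁ y , fromℕ< p<n) (r ∸ 1)
    columnWalk-top-bottom p<n = pathWalk (r ∸ 1) _ _ refl (trans (cong (_+ (r ∸ 1)) row-x) (sym row-y))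

    onColumnWalk-top-bottom : ∀ {p} (p<n : p < n) (v : V) → col v ≡ p → OnWalk v (columnWalk-top-bottom p<n)
    onColumnWalk-top-bottom p<n v col-v =
      onPathWalk (r ∸ 1) _ _ refl _ v (toℕ-injective (trans col-v (sym (toℕ-fromℕ< p<n))))
                 (≤-trans (≤-reflexive row-x) z≤n)
                 (≤-trans (<⇒≤pred (toℕ<n (proj₁ v))) (≤-reflexive (sym (cong (_+ (r ∸ 1)) row-x))))

    forwardThrough : ∀ {p} → i ≤ p → p ≤ c → c < n → (c ∸ i) + (c ∸ i) ≤ n → ThroughColumn x y p
    forwardThrough {p} i≤p p≤c c<n short = k , w , k≤ , cover
      where
      p<n = ≤-<-trans p≤c c<n
      w₁ = cycleWalk (p ∸ i) x (proj₁ x , fromℕ< p<n) refl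
                     (trans (cong (_+ (p ∸ i)) col-x) (trans (m+[n∸m]≡n i≤p) (sym (toℕ-fromℕ< p<n))))
      w₃ = cycleWalk (c ∸ p) (proj₁ y , fromℕ< p<n) y refl
                     (trans (cong (_+ (c ∸ p)) (toℕ-fromℕ< p<n)) (trans (m+[n∸m]≡n p≤c) (sym col-y)))
      k = (p ∸ i) + ((r ∸ 1) + (c ∸ p))
      w = w₁ ++ʷ (columnWalk-top-bottom p<n ++ʷ w₃)
      cover : ∀ v → col v ≡ p → OnWalk v w
      cover v col-v = onWalk-++ʳ w₁ (onWalk-++ˡ _ w₃ (onColumnWalk-top-bottom p<n v col-v))
      k≤ : k ≤ dist x y
      k≤ = ≤-reflexive (trans (forward-length (r ∸ 1) i p c i≤p p≤c)
                              (sym (trans dist≡ (cong ((r ∸ 1) +_) cycleDist≡))))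
        where
        cycleDist≡ = cycleDist-forward (≤-trans i≤p p≤c) (m+n≤o⇒m≤o∸n (c ∸ i) short)

    backwardThrough : ∀ {p f} → c ≤ p → p < n → i < c → i + n ≤ c + f → f + f ≤ n → ThroughColumn x y p
    backwardThrough {p} c≤p p<n i<c long f+f≤n = k , w , k≤ , cover
      where
      p≤n∸1 : p ≤ n ∸ 1
      p≤n∸1 = <⇒≤pred p<n
      top-left = proj₁ x , fromℕ< (0<n p<n)
      top-right = proj₁ x , fromℕ< (n∸1<n p<n)
      w₁ = cycleWalk⁻ i x top-left refl (trans (cong (_+ i) (toℕ-fromℕ< (0<n p<n))) (sym col-x))
      w₂ = cycleWalk⁻ ((n ∸ 1) ∸ p) top-right (proj₁ x , fromℕ< p<n) refl
                      (trans (cong (_+ ((n ∸ 1) ∸ p)) (toℕ-fromℕ< p<n))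
                             (trans (m+[n∸m]≡n p≤n∸1) (sym (toℕ-fromℕ< (n∸1<n p<n)))))
      w₄ = cycleWalk⁻ (p ∸ c) (proj₁ y , fromℕ< p<n) y refl
                      (trans (cong (_+ (p ∸ c)) col-y) (trans (m+[n∸m]≡n c≤p) (sym (toℕ-fromℕ< p<n))))
      k = i + suc (((n ∸ 1) ∸ p) + ((r ∸ 1) + (p ∸ c)))
      w = w₁ ++ʷ step (wrapEdge p<n (proj₁ x)) (w₂ ++ʷ (columnWalk-top-bottom p<n ++ʷ w₄))
      cover : ∀ v → col v ≡ p → OnWalk v w
      cover v col-v = onWalk-++ʳ w₁ (on-later _ (onWalk-++ʳ w₂
                        (onWalk-++ˡ _ w₄ (onColumnWalk-top-bottom p<n v col-v))))
      k≤ : k ≤ dist x y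
      k≤ = ≤-reflexive (trans (backward-length (r ∸ 1) i c p n i<c c≤p p<n)
                              (sym (trans dist≡ (cong ((r ∸ 1) +_) cycleDist≡))))
        where
        cycleDist≡ = cycleDist-backward (<⇒≤ i<c) (n∸[c∸i]≤c∸i (<⇒≤ i<c) long f+f≤n)

-- A strong geodetic set with a vertices in the first row and b in the last

⌈n/2⌉≤1+⌊n/2⌋ : ∀ n → ⌈ n /2⌉ ≤ suc ⌊ n /2⌋
⌈n/2⌉≤1+⌊n/2⌋ zero          = z≤n
⌈n/2⌉≤1+⌊n/2⌋ (suc zero)    = s≤s z≤n
⌈n/2⌉≤1+⌊n/2⌋ (suc (suc n)) = s≤s (⌈n/2⌉≤1+⌊n/2⌋ n)

⌈m+n/2⌉≤⌈m/2⌉+⌈n/2⌉ : ∀ m n → ⌈ m + n /2⌉ ≤ ⌈ m /2⌉ + ⌈ n /2⌉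
⌈m+n/2⌉≤⌈m/2⌉+⌈n/2⌉ zero          n = ≤-refl
⌈m+n/2⌉≤⌈m/2⌉+⌈n/2⌉ (suc zero)    n = s≤s (⌊n/2⌋≤⌈n/2⌉ n)
⌈m+n/2⌉≤⌈m/2⌉+⌈n/2⌉ (suc (suc m)) n = s≤s (⌈m+n/2⌉≤⌈m/2⌉+⌈n/2⌉ m n)

2≤m⇒1+⌈m/2⌉≤m : ∀ {m} → 2 ≤ m → suc ⌈ m /2⌉ ≤ m
2≤m⇒1+⌈m/2⌉≤m {suc (suc m)} (s≤s (s≤s _)) = ⌈n/2⌉<n m

m≤n+n⇒⌊m/2⌋≤n : ∀ {m n} → m ≤ n + n → ⌊ m /2⌋ ≤ n
m≤n+n⇒⌊m/2⌋≤n {n = n} m≤2n = ≤-trans (⌊n/2⌋-mono m≤2n) (≤-reflexive (sym (n≡⌊n+n/2⌋ n)))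

m<n+n⇒⌊m/2⌋<n : ∀ {m n} → m < n + n → ⌊ m /2⌋ < n
m<n+n⇒⌊m/2⌋<n {n = n} m<2n = ≤-trans (⌊n/2⌋-mono (s≤s m<2n)) (≤-reflexive (sym (n≡⌈n+n/2⌉ n)))

-- The top vertices are the columns 0 … a-1 of the first row, the bottom ones one column
-- c j in each block [j a, j a + a) of the last row.  Column j a + (i - t j) is covered by a
-- geodesic going forward from top vertex i when t j ≤ i, and column j a + (a - t j) + i by one
-- going backward round the cycle when i < t j; the split t j = ⌊ e j /2⌋ balances the two.
module Placement (n a b fl : ℕ) (2fl≤n : fl + fl ≤ n) (n≤2fl+1 : n ≤ suc (fl + fl)) (2≤a : 2 ≤ a)
                 (a≤fl+1 : a ≤ suc fl) (fl+a≤n : fl + a ≤ n) (blocks<n : ∀ j → j < b → j * a < n) where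

  excess : ℕ → ℕ
  excess j = j * a + a ∸ fl

  e : ℕ → ℕ
  e j = (excess j ⊔ 1) ⊓ (a + a)

  t : ℕ → ℕ
  t j = ⌊ e j /2⌋

  u : ℕ → ℕ
  u j = ⌈ e j /2⌉

  c : ℕ → ℕ
  c j = j * a + a ∸ u j

  e≤2a : ∀ j → e j ≤ a + a
  e≤2a j = m⊓n≤n _ _

  e≤ja+a : ∀ j → e j ≤ j * a + a
  e≤ja+a j = ≤-trans (m⊓n≤m _ _) (⊔-lub (m∸n≤m _ fl) (≤-trans (≤-trans (s≤s z≤n) 2≤a) (m≤n+m a (j * a))))

  e<2a⇒ja+a≤fl+e : ∀ j → e j < a + a → j * a + a ≤ fl + e j
  e<2a⇒ja+a≤fl+e j lt with ⊓-sel (excess j ⊔ 1) (a + a)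
  ... | inj₂ eq = ⊥-elim (<-irrefl eq lt)
  ... | inj₁ eq = ≤-trans (m≤n+m∸n (j * a + a) fl)
                          (+-monoʳ-≤ fl (≤-trans (m≤m⊔n (excess j) 1) (≤-reflexive (sym eq))))

  2≤e⇒e+fl≤ja+a : ∀ j → 2 ≤ e j → e j + fl ≤ j * a + a
  2≤e⇒e+fl≤ja+a j 2≤e with ⊔-sel (excess j) 1
  ... | inj₁ eq = ≤-trans (+-monoˡ-≤ fl e≤excess) (≤-reflexive (m∸n+n≡m fl≤ja+a))
    where
    e≤excess : e j ≤ excess j
    e≤excess = ≤-trans (m⊓n≤m _ _) (≤-reflexive eq)
    fl≤ja+a : fl ≤ j * a + a
    fl≤ja+a with fl ≤? j * a + a
    ... | yes p = p
    ... | no ¬p with ≤-trans 2≤e (≤-trans e≤excess (≤-reflexive (m≤n⇒m∸n≡0 (<⇒≤ (≰⇒> ¬p)))))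
    ...   | ()
  ... | inj₂ eq with ≤-trans 2≤e (≤-trans (m⊓n≤m _ _) (≤-reflexive eq))
  ...   | s≤s ()

  e₀≤1 : e 0 ≤ 1
  e₀≤1 = ≤-trans (m⊓n≤m _ _) (⊔-lub (≤-trans (∸-monoˡ-≤ fl a≤fl+1) (≤-reflexive (m+n∸n≡m 1 fl))) ≤-refl)

  c+u≡ja+a : ∀ j → c j + u j ≡ j * a + a
  c+u≡ja+a j = m∸n+n≡m (≤-trans (⌈n/2⌉≤n (e j)) (e≤ja+a j))

  t+u≡e : ∀ j → t j + u j ≡ e j
  t+u≡e j = ⌊n/2⌋+⌈n/2⌉≡n (e j)

  t≤u : ∀ j → t j ≤ u j
  t≤u j = ⌊n/2⌋≤⌈n/2⌉ (e j)

  t≤a : ∀ j → t j ≤ a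
  t≤a j = m≤n+n⇒⌊m/2⌋≤n (e≤2a j)

  t≤ja : ∀ j → t j ≤ j * a
  t≤ja zero    = ⌊n/2⌋-mono e₀≤1
  t≤ja (suc j) = ≤-trans (t≤a (suc j)) (m≤m+n a (j * a))

  c≤fl+t : ∀ j → e j < a + a → c j ≤ fl + t j
  c≤fl+t j lt = +-cancelʳ-≤ (u j) _ _
    (≤-trans (≤-reflexive (c+u≡ja+a j))
      (≤-trans (e<2a⇒ja+a≤fl+e j lt)
               (≤-reflexive (trans (cong (fl +_) (sym (t+u≡e j))) (sym (+-assoc fl (t j) (u j)))))))

  c<n : ∀ j → j < b → c j < n
  c<n j j<b with e j <? a + a
  ... | yes lt = ≤-<-trans (c≤fl+t j lt) (≤-trans (+-monoʳ-< fl (m<n+n⇒⌊m/2⌋<n lt)) fl+a≤n)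
  ... | no ¬lt = ≤-<-trans (≤-reflexive c≡ja) (blocks<n j j<b)
    where
    c≡ja : c j ≡ j * a
    c≡ja = trans (cong (λ z → j * a + a ∸ ⌈ z /2⌉) (≤-antisym (e≤2a j) (≮⇒≥ ¬lt)))
                 (trans (cong (j * a + a ∸_) (sym (n≡⌈n+n/2⌉ a))) (m+n∸n≡m (j * a) a))

  c<c[1+j] : ∀ j → c j < c (suc j)
  c<c[1+j] j = m+n≤o⇒m≤o∸n (suc (c j)) key
    where
    s = j * a
    a+s+a≡s+a+a : ∀ a s → a + s + a ≡ s + a + a
    a+s+a≡s+a+a = solve-∀
    excess≤ : excess (suc j) ≤ excess j + a
    excess≤ = ≤-trans (≤-reflexive (cong (_∸ fl) (a+s+a≡s+a+a a s))) (plusMinus (s + a) a fl)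
      where
      plusMinus : ∀ x y z → x + y ∸ z ≤ (x ∸ z) + y
      plusMinus zero    y z       = ≤-trans (m∸n≤m y z) (≤-reflexive (cong (_+ y) (sym (0∸n≡0 z))))
      plusMinus (suc x) y zero    = ≤-refl
      plusMinus (suc x) y (suc z) = plusMinus x y z
    e≤ : e (suc j) ≤ e j + a
    e≤ = ≤-trans (⊓-mono-≤ (⊔-lub (≤-trans excess≤ (+-monoˡ-≤ a (m≤m⊔n (excess j) 1)))
                                  (≤-trans (m≤n⊔m (excess j) 1) (m≤m+n _ a)))
                           (m≤m+n (a + a) a))
                 (≤-reflexive (sym (+-distribʳ-⊓ a (excess j ⊔ 1) (a + a))))
    1+⌈a/2⌉≤a : suc ⌈ a /2⌉ ≤ a
    1+⌈a/2⌉≤a = 2≤m⇒1+⌈m/2⌉≤m 2≤a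
    u<u+a : suc (u (suc j)) ≤ u j + a
    u<u+a = ≤-trans (s≤s (≤-trans (⌈n/2⌉-mono e≤) (⌈m+n/2⌉≤⌈m/2⌉+⌈n/2⌉ (e j) a)))
                    (≤-trans (≤-reflexive (sym (+-suc (u j) ⌈ a /2⌉))) (+-monoʳ-≤ (u j) 1+⌈a/2⌉≤a))
    key : suc (c j) + u (suc j) ≤ suc j * a + a
    key = ≤-trans (≤-reflexive (sym (+-suc (c j) _)))
            (≤-trans (+-monoʳ-≤ (c j) u<u+a)
              (≤-reflexive (trans (sym (+-assoc (c j) (u j) a))
                                  (trans (cong (_+ a) (c+u≡ja+a j)) (sym (a+s+a≡s+a+a a s))))))

  c<c[1+d+j] : ∀ j d → c j < c (suc d + j)
  c<c[1+d+j] j zero    = c<c[1+j] j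
  c<c[1+d+j] j (suc d) = <-trans (c<c[1+d+j] j d) (c<c[1+j] (suc d + j))

  c-strictMono : ∀ {j j'} → j < j' → c j < c j'
  c-strictMono {j} j<j' with m≤n⇒∃[o]m+o≡n j<j'
  ... | d , refl = subst (λ z → c j < c z) (cong suc (+-comm d j)) (c<c[1+d+j] j d)

  c-injective : ∀ {j j'} → c j ≡ c j' → j ≡ j'
  c-injective {j} {j'} eq with <-cmp j j'
  ... | tri< lt _ _ = ⊥-elim (<-irrefl eq (c-strictMono lt))
  ... | tri≈ _ e _  = e
  ... | tri> _ _ gt = ⊥-elim (<-irrefl (sym eq) (c-strictMono gt))

  coveredCol : ℕ → ℕ → ℕ
  coveredCol i j with t j ≤? i
  ... | yes _ = j * a + (i ∸ t j)
  ... | no _  = j * a + (a ∸ t j) + i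

  coveredCol-forward : ∀ i j → t j ≤ i → coveredCol i j ≡ j * a + (i ∸ t j)
  coveredCol-forward i j t≤i with t j ≤? i
  ... | yes _   = refl
  ... | no t≰i = ⊥-elim (t≰i t≤i)

  coveredCol-backward : ∀ i j → i < t j → coveredCol i j ≡ j * a + (a ∸ t j) + i
  coveredCol-backward i j i<t with t j ≤? i
  ... | yes t≤i = ⊥-elim (<-irrefl refl (<-≤-trans i<t t≤i))
  ... | no _    = refl

  forward-bounds : ∀ i j → t j ≤ i → i < a →
    (i ≤ j * a + (i ∸ t j)) × (j * a + (i ∸ t j) ≤ c j) × ((c j ∸ i) + (c j ∸ i) ≤ n)
  forward-bounds i j t≤i i<a = i≤p , p≤c , short
    where
    i≤p : i ≤ j * a + (i ∸ t j)
    i≤p = ≤-trans (≤-reflexive (sym (m+[n∸m]≡n t≤i))) (+-monoˡ-≤ (i ∸ t j) (t≤ja j))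
    i∸t+u≤a : (i ∸ t j) + u j ≤ a
    i∸t+u≤a = ≤-trans (+-monoʳ-≤ (i ∸ t j) (⌈n/2⌉≤1+⌊n/2⌋ (e j)))
                (≤-trans (≤-reflexive (+-suc (i ∸ t j) (t j))) (≤-trans (s≤s (≤-reflexive (m∸n+n≡m t≤i))) i<a))
    p≤c : j * a + (i ∸ t j) ≤ c j
    p≤c = m+n≤o⇒m≤o∸n (j * a + (i ∸ t j))
            (≤-trans (≤-reflexive (+-assoc (j * a) (i ∸ t j) (u j))) (+-monoʳ-≤ (j * a) i∸t+u≤a))
    e<2a : e j < a + a
    e<2a = ≤-trans (s≤s (≤-trans (≤-reflexive (sym (t+u≡e j))) (+-monoʳ-≤ (t j) (⌈n/2⌉≤1+⌊n/2⌋ (e j)))))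
                   (+-mono-≤ t<a t<a)
      where
      t<a = ≤-<-trans t≤i i<a
    c≤i+fl : c j ≤ i + fl
    c≤i+fl = ≤-trans (c≤fl+t j e<2a) (≤-trans (≤-reflexive (+-comm fl (t j))) (+-monoˡ-≤ fl t≤i))
    c∸i≤fl : c j ∸ i ≤ fl
    c∸i≤fl = ≤-trans (∸-monoˡ-≤ i c≤i+fl) (≤-reflexive (m+n∸m≡n i fl))
    short = ≤-trans (+-mono-≤ c∸i≤fl c∸i≤fl) 2fl≤n

  backward-bounds : ∀ i j → i < t j →
    (c j ≤ j * a + (a ∸ t j) + i) × (i < c j) × (i + n ≤ c j + fl)
  backward-bounds i j i<t = c≤p , i<c , long
    where
    c+t≤ja+a : c j + t j ≤ j * a + a
    c+t≤ja+a = ≤-trans (+-monoʳ-≤ (c j) (t≤u j)) (≤-reflexive (c+u≡ja+a j))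
    c≤p : c j ≤ j * a + (a ∸ t j) + i
    c≤p = ≤-trans (m+n≤o⇒m≤o∸n (c j) c+t≤ja+a)
                  (≤-trans (≤-reflexive (+-∸-assoc (j * a) (t≤a j))) (m≤m+n _ i))
    t≤c : t j ≤ c j
    t≤c = +-cancelʳ-≤ (u j) _ _
            (≤-trans (≤-reflexive (t+u≡e j)) (≤-trans (e≤ja+a j) (≤-reflexive (sym (c+u≡ja+a j)))))
    i<c : i < c j
    i<c = <-≤-trans i<t t≤c
    2≤e : 2 ≤ e j
    2≤e = ≤-trans (+-mono-≤ (≤-trans (s≤s z≤n) i<t) (≤-trans (≤-trans (s≤s z≤n) i<t) (t≤u j)))
                  (≤-reflexive (t+u≡e j))
    t+fl≤c : t j + fl ≤ c j
    t+fl≤c = +-cancelʳ-≤ (u j) _ _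
      (≤-trans (≤-reflexive (x+y+z≡x+z+y (t j) fl (u j)))
        (≤-trans (+-monoˡ-≤ fl (≤-reflexive (t+u≡e j)))
          (≤-trans (2≤e⇒e+fl≤ja+a j 2≤e) (≤-reflexive (sym (c+u≡ja+a j))))))
      where
      x+y+z≡x+z+y : ∀ x y z → x + y + z ≡ x + z + y
      x+y+z≡x+z+y = solve-∀
    long : i + n ≤ c j + fl
    long = ≤-trans (+-monoʳ-≤ i n≤2fl+1)
             (≤-trans (≤-reflexive (i+[1+f+f]≡1+i+f+f i fl))
               (≤-trans (+-monoˡ-≤ fl (+-monoˡ-≤ fl i<t)) (+-monoˡ-≤ fl t+fl≤c)))
      where
      i+[1+f+f]≡1+i+f+f : ∀ i f → i + suc (f + f) ≡ suc i + f + f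
      i+[1+f+f]≡1+i+f+f = solve-∀

  instance
    a≢0 : NonZero a
    a≢0 = >-nonZero (≤-trans (s≤s z≤n) 2≤a)

  coveredCol-onto : n ≤ b * a → ∀ q → q < n → Σ ℕ λ i → Σ ℕ λ j → i < a × j < b × coveredCol i j ≡ q
  coveredCol-onto n≤ba q q<n with q % a + t (q / a) <? a
  ... | yes lt = q % a + t j , j , lt , j<b ,
                 trans (coveredCol-forward _ j (m≤n+m (t j) (q % a)))
                       (trans (cong (j * a +_) (m+n∸n≡m (q % a) (t j))) (trans (+-comm (j * a) (q % a)) (sym q≡)))
    where
    j = q / a
    j<b : j < b
    j<b = m<n*o⇒m/o<n (≤-trans q<n n≤ba)
    q≡ : q ≡ q % a + j * a
    q≡ = m≡m%n+[m/n]*n q a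
  ... | no ¬lt = δ + t j ∸ a , j , i<a , j<b , trans (coveredCol-backward _ j i<t) col≡
    where
    j = q / a
    δ = q % a
    j<b : j < b
    j<b = m<n*o⇒m/o<n (≤-trans q<n n≤ba)
    q≡ : q ≡ δ + j * a
    q≡ = m≡m%n+[m/n]*n q a
    a≤δ+t : a ≤ δ + t j
    a≤δ+t = ≮⇒≥ ¬lt
    i<t : δ + t j ∸ a < t j
    i<t = +-cancelˡ-< a _ _ (≤-trans (≤-reflexive (cong suc (m+[n∸m]≡n a≤δ+t))) (+-monoˡ-≤ (t j) (m%n<n q a)))
    i<a : δ + t j ∸ a < a
    i<a = <-≤-trans i<t (t≤a j)
    col≡ : j * a + (a ∸ t j) + (δ + t j ∸ a) ≡ q
    col≡ = trans (+-assoc (j * a) (a ∸ t j) (δ + t j ∸ a))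
                 (trans (cong (j * a +_) mid) (trans (+-comm (j * a) δ) (sym q≡)))
      where
      x+y+z≡x+z+y : ∀ x y z → x + y + z ≡ x + z + y
      x+y+z≡x+z+y = solve-∀
      mid : (a ∸ t j) + (δ + t j ∸ a) ≡ δ
      mid = +-cancelʳ-≡ (t j) _ _
              (trans (x+y+z≡x+z+y (a ∸ t j) (δ + t j ∸ a) (t j))
                     (trans (cong (_+ (δ + t j ∸ a)) (m∸n+n≡m (t≤a j))) (m+[n∸m]≡n a≤δ+t)))

module UpperBound (r n a b fl : ℕ) (2≤r : 2 ≤ r) (2fl≤n : fl + fl ≤ n) (n≤2fl+1 : n ≤ suc (fl + fl))
                  (2≤a : 2 ≤ a) (a≤fl+1 : a ≤ suc fl) (fl+a≤n : fl + a ≤ n)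
                  (blocks<n : ∀ j → j < b → j * a < n) (n≤ba : n ≤ b * a) where

  open Grid r n
  open Placement n a b fl 2fl≤n n≤2fl+1 2≤a a≤fl+1 fl+a≤n blocks<n

  0<r : 0 < r
  0<r = ≤-trans (s≤s z≤n) 2≤r

  r∸1<r : r ∸ 1 < r
  r∸1<r = ≤-trans (≤-reflexive (suc-pred r {{>-nonZero 0<r}})) ≤-refl

  a≤n : a ≤ n
  a≤n = ≤-trans (m≤n+m a fl) fl+a≤n

  -- the indices ℓ ≥ a + b are never used
  terminal : ℕ → V
  terminal ℓ with ℓ <? a
  ... | yes ℓ<a = fromℕ< 0<r , fromℕ< (<-≤-trans ℓ<a a≤n)
  ... | no _ with ℓ ∸ a <? b
  ...   | yes j<b = fromℕ< r∸1<r , fromℕ< (c<n (ℓ ∸ a) j<b)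
  ...   | no _    = fromℕ< 0<r , fromℕ< (<-≤-trans (≤-trans (s≤s z≤n) 2≤a) a≤n)

  terminal-top : ∀ ℓ → ℓ < a → row (terminal ℓ) ≡ 0 × col (terminal ℓ) ≡ ℓ
  terminal-top ℓ ℓ<a with ℓ <? a
  ... | yes ℓ<a' = toℕ-fromℕ< 0<r , toℕ-fromℕ< (<-≤-trans ℓ<a' a≤n)
  ... | no ℓ≮a   = ⊥-elim (ℓ≮a ℓ<a)

  terminal-bottom : ∀ ℓ → a ≤ ℓ → ℓ ∸ a < b → row (terminal ℓ) ≡ r ∸ 1 × col (terminal ℓ) ≡ c (ℓ ∸ a)
  terminal-bottom ℓ a≤ℓ j<b with ℓ <? a
  ... | yes ℓ<a = ⊥-elim (<-irrefl refl (<-≤-trans ℓ<a a≤ℓ))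
  ... | no _ with ℓ ∸ a <? b
  ...   | yes j<b' = toℕ-fromℕ< r∸1<r , toℕ-fromℕ< (c<n (ℓ ∸ a) j<b')
  ...   | no j≮b   = ⊥-elim (j≮b j<b)

  r∸1≢0 : r ∸ 1 ≢ 0
  r∸1≢0 = go 2≤r
    where
    go : ∀ {m} → 2 ≤ m → m ∸ 1 ≢ 0
    go (s≤s (s≤s _)) ()

  terminals-unique : Unique (applyUpTo terminal (a + b))
  terminals-unique = applyUpTo⁺₁ terminal (a + b) distinct
    where
    distinct : ∀ {i j} → i < j → j < a + b → terminal i ≢ terminal j
    distinct {i} {j} i<j j<a+b eq with a ≤? j | a ≤? i
    ... | no a≰j | _ = <-irrefl (trans (sym (proj₂ (terminal-top i (<-trans i<j j<a))))
                                       (trans (cong col eq) (proj₂ (terminal-top j j<a)))) i<j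
      where
      j<a = ≰⇒> a≰j
    ... | yes a≤j | no a≰i = r∸1≢0 (trans (sym (proj₁ (terminal-bottom j a≤j j∸a<b)))
                                          (trans (cong row (sym eq)) (proj₁ (terminal-top i (≰⇒> a≰i)))))
      where
      j∸a<b = +-cancelˡ-< a _ _ (≤-trans (≤-reflexive (cong suc (m+[n∸m]≡n a≤j))) j<a+b)
    ... | yes a≤j | yes a≤i = <-irrefl (c-injective (trans (sym (proj₂ (terminal-bottom i a≤i i∸a<b)))
                                                         (trans (cong col eq) (proj₂ (terminal-bottom j a≤j j∸a<b)))))
                                       i∸a<j∸a
      where
      j∸a<b = +-cancelˡ-< a _ _ (≤-trans (≤-reflexive (cong suc (m+[n∸m]≡n a≤j))) j<a+b)
      i∸a<j∸a = ∸-monoˡ-< i<j a≤i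
      i∸a<b = <-trans i∸a<j∸a j∸a<b

  module _ (x y : V) {i j : ℕ} (i<a : i < a) (j<b : j < b) (row-x : row x ≡ 0) (col-x : col x ≡ i)
           (row-y : row y ≡ r ∸ 1) (col-y : col y ≡ c j) where

    open TopToBottom x y row-x col-x row-y col-y

    forward : t j ≤ i → ThroughColumn x y (j * a + (i ∸ t j))
    forward t≤i = forwardThrough (proj₁ bounds) (proj₁ (proj₂ bounds)) (c<n j j<b) (proj₂ (proj₂ bounds))
      where
      bounds = forward-bounds i j t≤i i<a

    backward : i < t j → j * a + (a ∸ t j) + i < n → ThroughColumn x y (j * a + (a ∸ t j) + i)
    backward i<t p<n = backwardThrough (proj₁ bounds) p<n (proj₁ (proj₂ bounds)) (proj₂ (proj₂ bounds)) 2fl≤n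
      where
      bounds = backward-bounds i j i<t

    blockGeodesic : Geodesic E x y
    blockGeodesic with t j ≤? i
    ... | yes t≤i = throughColumn-geodesic (forward t≤i)
    ... | no t≰i with j * a + (a ∸ t j) + i <? n
    ...   | yes p<n = throughColumn-geodesic (backward (≰⇒> t≰i) p<n)
    ...   | no _    = someGeodesic x y

    onBlockGeodesic : ∀ v → col v ≡ coveredCol i j → coveredCol i j < n → OnGeodesic v blockGeodesic
    onBlockGeodesic v col-v q<n with t j ≤? i
    ... | yes t≤i = onGeodesic-throughColumn (forward t≤i) v col-v
    ... | no t≰i with j * a + (a ∸ t j) + i <? n
    ...   | yes p<n = onGeodesic-throughColumn (backward (≰⇒> t≰i) p<n) v col-v
    ...   | no p≮n  = ⊥-elim (p≮n q<n)

  -- deciding a ≤? i rather than i <? a keeps the goal's terminal i from being with-abstracted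
  terminalGeodesic : (i J : ℕ) → Geodesic E (terminal i) (terminal J)
  terminalGeodesic i J with a ≤? i | a ≤? J | b ≤? J ∸ a
  ... | no a≰i | yes a≤J | no b≰J∸a =
    blockGeodesic (terminal i) (terminal J) i<a J∸a<b (proj₁ top) (proj₂ top) (proj₁ bottom) (proj₂ bottom)
    where
    i<a = ≰⇒> a≰i
    J∸a<b = ≰⇒> b≰J∸a
    top = terminal-top i i<a
    bottom = terminal-bottom J a≤J J∸a<b
  ... | _ | _ | _ = someGeodesic (terminal i) (terminal J)

  onTerminalGeodesic : ∀ i j v → i < a → j < b → col v ≡ coveredCol i j →
                       OnGeodesic v (terminalGeodesic i (a + j))
  onTerminalGeodesic i j v i<a j<b col-v with a ≤? i | a ≤? a + j | b ≤? a + j ∸ a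
  ... | no _ | yes _ | no _ =
    onBlockGeodesic _ _ _ _ _ _ _ _ v (trans col-v (cong (coveredCol i) (sym j≡)))
                    (subst (_< n) (cong (coveredCol i) (sym j≡)) (subst (_< n) col-v (toℕ<n (proj₂ v))))
    where
    j≡ = m+n∸m≡n a j
  ... | yes a≤i | _ | _ = ⊥-elim (<-irrefl refl (<-≤-trans i<a a≤i))
  ... | no _ | no a≰a+j | _ = ⊥-elim (a≰a+j (m≤m+n a j))
  ... | no _ | yes _ | yes b≤ = ⊥-elim (<-irrefl refl (<-≤-trans j<b (≤-trans b≤ (≤-reflexive (m+n∸m≡n a j)))))

  strongGeodeticSet : Σ (List V) λ S → Unique S × length S ≡ a + b × StrongGeodetic E S
  strongGeodeticSet = applyUpTo terminal (a + b) , terminals-unique , length-applyUpTo terminal (a + b) ,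
                      strongGeodetic-applyUpTo (a + b) terminal terminalGeodesic cover
    where
    cover : ∀ v → Σ ℕ λ i → Σ ℕ λ J → i < J × J < a + b × OnGeodesic v (terminalGeodesic i J)
    cover v with coveredCol-onto n≤ba (col v) (toℕ<n (proj₂ v))
    ... | i , j , i<a , j<b , col≡ = i , a + j , <-≤-trans i<a (m≤m+n a j) , +-monoʳ-< a j<b ,
                                     onTerminalGeodesic i j v i<a j<b (sym col≡)

-- Counting visits of walks to rows

∣m-n∣≡m⊔n∸m⊓n : ∀ m n → ∣ m - n ∣ ≡ m ⊔ n ∸ m ⊓ n
∣m-n∣≡m⊔n∸m⊓n m n with ≤-total m n
... | inj₁ m≤n rewrite m≤n⇒m⊔n≡n m≤n | m≤n⇒m⊓n≡m m≤n = trans (∣-∣-comm m n) (m≤n⇒∣n-m∣≡n∸m m≤n)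
... | inj₂ n≤m rewrite m≥n⇒m⊔n≡m n≤m | m≥n⇒m⊓n≡n n≤m = m≤n⇒∣n-m∣≡n∸m n≤m

module LowerBound (r n : ℕ) where

  open Grid r n

  rowVisits : ∀ {u v : V} {k} → Walk E u v k → ℕ → ℕ
  rowVisits {v = v} here       t = 𝟙 (row v ≟ t)
  rowVisits {u = u} (step _ w) t = 𝟙 (row u ≟ t) + rowVisits w t

  visits : ∀ {u v : V} {k} → Walk E u v k → ℕ → ℕ → ℕ
  visits {v = v} here       t x = 𝟙 (row v ≟ t) * 𝟙 (col v ≟ x)
  visits {u = u} (step _ w) t x = 𝟙 (row u ≟ t) * 𝟙 (col u ≟ x) + visits w t x

  sumTo-rowVisits : ∀ {u v : V} {k} (w : Walk E u v k) → sumTo r (rowVisits w) ≡ suc k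
  sumTo-rowVisits {v = v} here       = sumTo-𝟙≡ r (row v) (toℕ<n (proj₁ v))
  sumTo-rowVisits {u = u} (step e w) =
    trans (sumTo-+ r (λ t → 𝟙 (row u ≟ t)) (rowVisits w))
          (cong₂ _+_ (sumTo-𝟙≡ r (row u) (toℕ<n (proj₁ u))) (sumTo-rowVisits w))

  sumTo-visit : ∀ (x : V) t → sumTo n (λ y → 𝟙 (row x ≟ t) * 𝟙 (col x ≟ y)) ≡ 𝟙 (row x ≟ t)
  sumTo-visit x t = trans (sumTo-*ˡ n (𝟙 (row x ≟ t)) (λ y → 𝟙 (col x ≟ y)))
                          (trans (cong (𝟙 (row x ≟ t) *_) (sumTo-𝟙≡ n (col x) (toℕ<n (proj₂ x))))
                                 (*-identityʳ _))

  sumTo-visits : ∀ {u v : V} {k} (w : Walk E u v k) t → sumTo n (visits w t) ≡ rowVisits w t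
  sumTo-visits {v = v} here       t = sumTo-visit v t
  sumTo-visits {u = u} (step e w) t =
    trans (sumTo-+ n (λ y → 𝟙 (row u ≟ t) * 𝟙 (col u ≟ y)) (visits w t))
          (cong₂ _+_ (sumTo-visit u t) (sumTo-visits w t))

  visit-self : ∀ x → 𝟙 (row x ≟ row x) * 𝟙 (col x ≟ col x) ≡ 1
  visit-self x = cong₂ _*_ (𝟙-yes (row x ≟ row x) refl) (𝟙-yes (col x ≟ col x) refl)

  onWalk⇒visited : ∀ {u v : V} {k} (w : Walk E u v k) (x : V) → OnWalk x w → 1 ≤ visits w (row x) (col x)
  onWalk⇒visited here       x on-here        = ≤-reflexive (sym (visit-self x))
  onWalk⇒visited (step e w) x (on-start e w) = ≤-trans (≤-reflexive (sym (visit-self x))) (m≤m+n _ _)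
  onWalk⇒visited (step e w) x (on-later e o) = ≤-trans (onWalk⇒visited w x o) (m≤n+m _ _)

  E-row-step : ∀ {x y : V} → E x y → row y ≤ suc (row x) × row x ≤ suc (row y)
  E-row-step (inj₁ (refl , _))     = n≤1+n _ , n≤1+n _
  E-row-step (inj₂ (_ , inj₁ e)) = ≤-reflexive (sym e) , ≤-trans (≤-trans (n≤1+n _) (≤-reflexive e)) (n≤1+n _)
  E-row-step (inj₂ (_ , inj₂ e)) = ≤-trans (n≤1+n _) (≤-trans (≤-reflexive e) (n≤1+n _)) , ≤-reflexive (sym e)

  Within : ℕ → ℕ → ℕ → Set
  Within a b t = (a ≤ t × t ≤ b) ⊎ (b ≤ t × t ≤ a)

  rowVisits-between : ∀ {u v : V} {k} (w : Walk E u v k) t → Within (row u) (row v) t → 1 ≤ rowVisits w t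
  rowVisits-between {v = v} here t (inj₁ (p , q)) = ≤-reflexive (sym (𝟙-yes (row v ≟ t) (≤-antisym p q)))
  rowVisits-between {v = v} here t (inj₂ (p , q)) = ≤-reflexive (sym (𝟙-yes (row v ≟ t) (≤-antisym p q)))
  rowVisits-between {u = u} (step {y = y} e w) t between with row u ≟ t
  ... | yes _   = s≤s z≤n
  ... | no u≢t = rowVisits-between w t (next between)
    where
    next : Within (row u) _ t → Within (row y) _ t
    next (inj₁ (p , q)) = inj₁ (≤-trans (proj₁ (E-row-step e)) (≤∧≢⇒< p u≢t) , q)
    next (inj₂ (p , q)) = inj₂ (p , ≤-pred (≤-trans (≤∧≢⇒< q (u≢t ∘ sym)) (proj₂ (E-row-step e))))

  fl : ℕ
  fl = n / 2

  module _ (S : List V) (g : (I J : Fin (length S)) → I F.< J → Geodesic E (lookup S I) (lookup S J)) where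

    s : ℕ
    s = length S

    rowOf : Fin s → ℕ
    rowOf I = row (lookup S I)

    inRow : ℕ → ℕ
    inRow t = sumFin (λ I → 𝟙 (rowOf I ≟ t))

    empty : ℕ → ℕ
    empty t = 𝟙 (inRow t ≟ 0)

    rowOf-nonempty : ∀ I t → rowOf I ≡ t → inRow t ≢ 0
    rowOf-nonempty I t row≡t inRow≡0 =
      <-irrefl (sym inRow≡0) (≤-trans (≤-reflexive (sym (𝟙-yes (rowOf I ≟ t) row≡t)))
                                      (sumFin-term (λ I → 𝟙 (rowOf I ≟ t)) I))

    walkOf : (I J : Fin s) (p : I F.< J) → Walk E (lookup S I) (lookup S J) (Geodesic.len (g I J p))
    walkOf I J p = Geodesic.walk (g I J p)

    -- A geodesic between rows A and B has at most |A - B| + fl + 1 vertices and visits every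
    -- row of [A, B]; on the rows containing a vertex of S this accounts for all but fl + (number of
    -- empty rows in [A, B]) of them, and the empty rows of [A, B] lie strictly between A and B.
    module _ (I J : Fin s) (p : I F.< J) where
      private
        A = rowOf I
        B = rowOf J
        K = Geodesic.len (g I J p)
        visitsOf = rowVisits (walkOf I J p)

      length≤ : K ≤ (A ⊔ B ∸ A ⊓ B) + fl
      length≤ = ≤-trans (geodesic-len≤dist (g I J p))
                        (≤-trans (+-monoʳ-≤ ∣ A - B ∣ (cycleDist≤⌊n/2⌋ (col (lookup S I)) (col (lookup S J))))
                                 (≤-reflexive (cong (_+ fl) (∣m-n∣≡m⊔n∸m⊓n A B))))

      closedInterval≤visits : ∀ t → closedInterval A B t ≤ visitsOf t
      closedInterval≤visits t with A ⊓ B ≤? t | t ≤? A ⊔ B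
      ... | yes lo≤t | yes t≤hi = rowVisits-between (walkOf I J p) t within
        where
        within : Within A B t
        within with ≤-total A B
        ... | inj₁ A≤B = inj₁ (≤-trans (≤-reflexive (sym (m≤n⇒m⊓n≡m A≤B))) lo≤t ,
                               ≤-trans t≤hi (≤-reflexive (m≤n⇒m⊔n≡n A≤B)))
        ... | inj₂ B≤A = inj₂ (≤-trans (≤-reflexive (sym (m≥n⇒m⊓n≡n B≤A))) lo≤t ,
                               ≤-trans t≤hi (≤-reflexive (m≥n⇒m⊔n≡m B≤A)))
      ... | yes _ | no _  = z≤n
      ... | no _  | yes _ = z≤n
      ... | no _  | no _  = z≤n

      empty*closed≡empty*open : ∀ t → empty t * closedInterval A B t ≡ empty t * openInterval A B t
      empty*closed≡empty*open t with inRow t ≟ 0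
      ... | no _        = refl
      ... | yes inRow≡0 = cong (1 *_) (cong₂ _*_ lower upper)
        where
        A≢t : A ≢ t
        A≢t A≡t = rowOf-nonempty I t A≡t inRow≡0
        B≢t : B ≢ t
        B≢t B≡t = rowOf-nonempty J t B≡t inRow≡0
        lo≢t : A ⊓ B ≢ t
        lo≢t lo≡t with ⊓-sel A B
        ... | inj₁ e = A≢t (trans (sym e) lo≡t)
        ... | inj₂ e = B≢t (trans (sym e) lo≡t)
        hi≢t : A ⊔ B ≢ t
        hi≢t hi≡t with ⊔-sel A B
        ... | inj₁ e = A≢t (trans (sym e) hi≡t)
        ... | inj₂ e = B≢t (trans (sym e) hi≡t)
        lower : 𝟙 (A ⊓ B ≤? t) ≡ 𝟙 (A ⊓ B <? t)
        lower = 𝟙-cong (A ⊓ B ≤? t) (A ⊓ B <? t) (λ le → ≤∧≢⇒< le lo≢t) <⇒≤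
        upper : 𝟙 (t ≤? A ⊔ B) ≡ 𝟙 (t <? A ⊔ B)
        upper = 𝟙-cong (t ≤? A ⊔ B) (t <? A ⊔ B) (λ le → ≤∧≢⇒< le (hi≢t ∘ sym)) <⇒≤

      emptyRowVisits≤ : sumTo r (λ t → empty t * visitsOf t) ≤ fl + sumTo r (λ t → empty t * openInterval A B t)
      emptyRowVisits≤ = subst (λ z → sumTo r (λ t → empty t * visitsOf t) ≤ fl + z)
                              (sumTo-cong r (λ t _ → empty*closed≡empty*open t))
                              (cancel total-visits total-interval nonempty≤ length≤)
        where
        split : ∀ f → sumTo r (λ t → empty t * f t) + sumTo r (λ t → (1 ∸ empty t) * f t) ≡ sumTo r f
        split f = trans (sym (sumTo-+ r _ _)) (sumTo-cong r (λ t _ → 𝟙-split (empty t) (f t) (𝟙≤1 (inRow t ≟ 0))))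
        total-visits = trans (split visitsOf) (sumTo-rowVisits (walkOf I J p))
        total-interval = trans (split (closedInterval A B))
                               (sumTo-interval r (A ⊓ B) (A ⊔ B) (m⊓n≤m⊔n A B)
                                               (⊔-lub (toℕ<n (proj₁ (lookup S I))) (toℕ<n (proj₁ (lookup S J)))))
        nonempty≤ = sumTo-mono r (λ t _ → *-monoʳ-≤ (1 ∸ empty t) (closedInterval≤visits t))
        cancel : ∀ {X Y X' Y' k d} → X + Y ≡ suc k → X' + Y' ≡ suc d → Y' ≤ Y → k ≤ d + fl → X ≤ fl + X'
        cancel {X} {Y} {X'} {Y'} {k} {d} X+Y≡ X'+Y'≡ Y'≤Y k≤ =
          +-cancelʳ-≤ Y' X (fl + X')
            (≤-trans (+-monoʳ-≤ X Y'≤Y)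
              (≤-trans (≤-reflexive X+Y≡)
                (≤-trans (s≤s k≤) (≤-reflexive (trans (cong (_+ fl) (sym X'+Y'≡)) (rearrange X' Y' fl))))))
          where
          rearrange : ∀ a b c → a + b + c ≡ c + a + b
          rearrange = solve-∀

    visitsIn : ℕ → ℕ
    visitsIn t = sumPairs (λ I J p → rowVisits (walkOf I J p) t)

    separatedBy : ℕ → ℕ
    separatedBy t = sumPairs (λ I J _ → openInterval (rowOf I) (rowOf J) t)

    emptyRowsVisits≤ : sumTo r (λ t → empty t * visitsIn t) ≤ fl * (s C 2) + sumTo r (λ t → empty t * separatedBy t)
    emptyRowsVisits≤ = begin
      sumTo r (λ t → empty t * visitsIn t)
        ≡⟨ swap (λ t I J p → rowVisits (walkOf I J p) t) ⟩
      sumPairs (λ I J p → sumTo r (λ t → empty t * rowVisits (walkOf I J p) t))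
        ≤⟨ sumPairs-mono emptyRowVisits≤ ⟩
      sumPairs (λ I J p → fl + sumTo r (λ t → empty t * openInterval (rowOf I) (rowOf J) t))
        ≡⟨ sumPairs-+ {s} (λ _ _ _ → fl) (λ I J p → sumTo r (λ t → empty t * openInterval (rowOf I) (rowOf J) t)) ⟩
      sumPairs {s} (λ _ _ _ → fl) + sumPairs (λ I J p → sumTo r (λ t → empty t * openInterval (rowOf I) (rowOf J) t))
        ≡⟨ cong₂ _+_ pairs≡ (sym (swap (λ t I J _ → openInterval (rowOf I) (rowOf J) t))) ⟩
      fl * (s C 2) + sumTo r (λ t → empty t * separatedBy t) ∎
      where
      open ≤-Reasoning
      swap : (φ : ℕ → Pairwise s) →
             sumTo r (λ t → empty t * sumPairs (φ t)) ≡ sumPairs (λ I J p → sumTo r (λ t → empty t * φ t I J p))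
      swap φ = trans (sumTo-cong r (λ t _ → sym (sumPairs-*ˡ (empty t) (φ t))))
                     (sumTo-sumPairs-comm r (λ t I J p → empty t * φ t I J p))
      pairs≡ : sumPairs {s} (λ _ _ _ → fl) ≡ fl * (s C 2)
      pairs≡ = trans (sumPairs-cong {s} (λ _ _ _ → sym (*-identityʳ fl)))
                     (trans (sumPairs-*ˡ {s} fl (λ _ _ _ → 1)) (cong (fl *_) (sumPairs-ones {s})))

    sumTo-inRow : sumTo r inRow ≡ s
    sumTo-inRow = trans (sumTo-sumFin-comm r (λ I t → 𝟙 (rowOf I ≟ t)))
                        (trans (sumFin-cong (λ I → sumTo-𝟙≡ r (rowOf I) (toℕ<n (proj₁ (lookup S I))))) sumFin-ones)

    r≤s+empties : r ≤ s + sumTo r empty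
    r≤s+empties = begin
      r                                   ≡⟨ sym (sumTo-ones r) ⟩
      sumTo r (λ _ → 1)                   ≤⟨ sumTo-mono r (λ t _ → 1≤inRow+empty t) ⟩
      sumTo r (λ t → inRow t + empty t)   ≡⟨ trans (sumTo-+ r inRow empty) (cong (_+ sumTo r empty) sumTo-inRow) ⟩
      s + sumTo r empty                   ∎
      where
      open ≤-Reasoning
      1≤inRow+empty : ∀ t → 1 ≤ inRow t + empty t
      1≤inRow+empty t with inRow t ≟ 0
      ... | yes _  = m≤n+m 1 (inRow t)
      ... | no ≢0 = ≤-trans (n≢0⇒n>0 ≢0) (m≤m+n (inRow t) 0)

    module _ (cover : (v : V) → ∃[ I ] ∃[ J ] Σ (I F.< J) λ p → OnGeodesic v (g I J p)) where

      n≤visitsIn : ∀ t → t < r → n ≤ visitsIn t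
      n≤visitsIn t t<r = begin
        n
          ≡⟨ sym (sumTo-ones n) ⟩
        sumTo n (λ _ → 1)
          ≤⟨ sumTo-mono n covered ⟩
        sumTo n (λ x → sumPairs (λ I J p → visits (walkOf I J p) t x))
          ≡⟨ sumTo-sumPairs-comm n (λ x I J p → visits (walkOf I J p) t x) ⟩
        sumPairs (λ I J p → sumTo n (visits (walkOf I J p) t))
          ≡⟨ sumPairs-cong (λ I J p → sumTo-visits (walkOf I J p) t) ⟩
        visitsIn t ∎
        where
        open ≤-Reasoning
        covered : ∀ x → x < n → 1 ≤ sumPairs (λ I J p → visits (walkOf I J p) t x)
        covered x x<n with cover (fromℕ< t<r , fromℕ< x<n)
        ... | I , J , p , on = ≤-trans (subst₂ (λ a b → 1 ≤ visits (walkOf I J p) a b) (toℕ-fromℕ< t<r) (toℕ-fromℕ< x<n)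
                                                (onWalk⇒visited (walkOf I J p) _ on))
                                        (sumPairs-term (λ I J p → visits (walkOf I J p) t x) I J p)

      lowerBound : s * s < 4 * n → r ≤ s + fl * (s C 2)
      lowerBound s²<4n = ≤-trans r≤s+empties (+-monoʳ-≤ s empties≤)
        where
        open Separation rowOf
        extra : ∀ t → t < r → empty t * suc (separatedBy t) ≤ empty t * visitsIn t
        extra t t<r with inRow t ≟ 0
        ... | yes _ = *-monoʳ-≤ 1 (≤-trans (separated< t s²<4n) (n≤visitsIn t t<r))
        ... | no _  = z≤n
        X = sumTo r (λ t → empty t * separatedBy t)
        empties≤ : sumTo r empty ≤ fl * (s C 2)
        empties≤ = +-cancelʳ-≤ X _ _
          (≤-trans (≤-reflexive (sym (trans (sumTo-cong r (λ t _ → *-suc (empty t) (separatedBy t)))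
                                             (sumTo-+ r empty (λ t → empty t * separatedBy t)))))
                   (≤-trans (sumTo-mono r extra) emptyRowsVisits≤))

-- Splitting k = ⌈2√n⌉ into the two rows

x+x≤1+y+y⇒x≤y : ∀ x y → x + x ≤ suc (y + y) → x ≤ y
x+x≤1+y+y⇒x≤y x y h with x ≤? y
... | yes x≤y = x≤y
... | no x≰y  = ⊥-elim (<-irrefl refl (≤-<-trans (≤-trans (≤-reflexive (identity y)) (+-mono-≤ y<x y<x)) (s≤s h)))
  where
  y<x = ≰⇒> x≰y
  identity : ∀ y → suc (suc (y + y)) ≡ suc y + suc y
  identity = solve-∀

n/2+n/2≤n : ∀ n → n / 2 + n / 2 ≤ n
n/2+n/2≤n n = ≤-trans (≤-reflexive (sym (x*2≡x+x (n / 2))))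
                      (≤-trans (m≤n+m _ (n % 2)) (≤-reflexive (sym (m≡m%n+[m/n]*n n 2))))
  where
  x*2≡x+x : ∀ x → x * 2 ≡ x + x
  x*2≡x+x = solve-∀

n≤1+n/2+n/2 : ∀ n → n ≤ suc (n / 2 + n / 2)
n≤1+n/2+n/2 n = ≤-trans (≤-reflexive (m≡m%n+[m/n]*n n 2))
                        (≤-trans (+-monoˡ-≤ ((n / 2) * 2) (≤-pred (m%n<n n 2))) (≤-reflexive (cong suc (x*2≡x+x (n / 2)))))
  where
  x*2≡x+x : ∀ x → x * 2 ≡ x + x
  x*2≡x+x = solve-∀

C2-mono : ∀ {m k} → m ≤ k → m C 2 ≤ k C 2
C2-mono {m} m≤k with m≤n⇒∃[o]m+o≡n m≤k
... | d , refl = ≤-trans (go d) (≤-reflexive (cong (_C 2) (+-comm d m)))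
  where
  go : ∀ d → m C 2 ≤ (d + m) C 2
  go zero    = ≤-refl
  go (suc d) = ≤-trans (go d) (≤-trans (m≤n+m _ _) (≤-reflexive (nCk+nC[k+1]≡[n+1]C[k+1] (d + m) 1)))

ceil2Sqrt≥4 : ∀ {n k} → 3 ≤ n → 4 * n ≤ k * k → 4 ≤ k
ceil2Sqrt≥4 {n} {k} 3≤n 4n≤k² with 4 ≤? k
... | yes 4≤k = 4≤k
... | no 4≰k  = ⊥-elim (small k (≤-pred (≰⇒> 4≰k)) (≤-trans (*-monoʳ-≤ 4 3≤n) 4n≤k²))
  where
  small : ∀ k → k ≤ 3 → ¬ (12 ≤ k * k)
  small 0 _ ()
  small 1 _ (s≤s ())
  small 2 _ (s≤s (s≤s (s≤s (s≤s ()))))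
  small 3 _ (s≤s (s≤s (s≤s (s≤s (s≤s (s≤s (s≤s (s≤s (s≤s ())))))))))
  small (suc (suc (suc (suc _)))) (s≤s (s≤s (s≤s ()))) _

ceil2Sqrt-minimal : ∀ {n k} → IsCeil2Sqrt n (suc k) → k * k < 4 * n
ceil2Sqrt-minimal {n} {k} (_ , least) with 4 * n ≤? k * k
... | yes 4n≤k² = ⊥-elim (<-irrefl refl (least k 4n≤k²))
... | no 4n≰k²  = ≰⇒> 4n≰k²

parity : ∀ k → Σ ℕ λ b → (k ≡ b + b) ⊎ (k ≡ suc (b + b))
parity zero          = 0 , inj₁ refl
parity (suc zero)    = 0 , inj₂ refl
parity (suc (suc k)) with parity k
... | b , inj₁ refl = suc b , inj₁ (cong suc (sym (+-suc b b)))
... | b , inj₂ refl = suc b , inj₂ (cong (suc ∘ suc) (sym (+-suc b b)))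

record BlockSplit (n k : ℕ) : Set where
  field
    a b       : ℕ
    a+b≡k     : a + b ≡ k
    2≤a       : 2 ≤ a
    a+a≤1+n   : a + a ≤ suc n
    blocks<n  : ∀ j → j < b → j * a < n
    n≤ba      : n ≤ b * a

3≰2 : ∀ {c} → ¬ (suc (suc (suc c)) ≤ 2)
3≰2 (s≤s (s≤s ()))

blockSplit-even : ∀ n m → 4 ≤ m + m → IsCeil2Sqrt n (m + m) → BlockSplit n (m + m)
blockSplit-even n (suc zero) (s≤s (s≤s ()))
blockSplit-even n (suc (suc c)) _ ceil = record
  { a = m ; b = m ; a+b≡k = refl ; 2≤a = s≤s (s≤s z≤n) ; a+a≤1+n = a+a≤1+n ; blocks<n = blocks<n ; n≤ba = n≤ba }
  where
  m = suc (suc c)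
  [m+m]²≡4m² : ∀ m → (m + m) * (m + m) ≡ 4 * (m * m)
  [m+m]²≡4m² = solve-∀
  n≤ba : n ≤ m * m
  n≤ba = *-cancelˡ-≤ 4 (≤-trans (proj₁ ceil) (≤-reflexive ([m+m]²≡4m² m)))
  odd² : ∀ c → (c + suc c) * (c + suc c) ≡ suc (4 * (c * suc c))
  odd² = solve-∀
  last<n : suc c * m < n
  last<n = *-cancelˡ-< 4 _ _ (≤-trans (n≤1+n _) (≤-trans (s≤s (≤-reflexive (sym (odd² (suc c)))))
                                                          (ceil2Sqrt-minimal {n} {suc (c + m)} ceil)))
  blocks<n : ∀ j → j < m → j * m < n
  blocks<n j j<m = ≤-<-trans (*-monoˡ-≤ m (≤-pred j<m)) last<n
  a+a≤1+n : m + m ≤ suc n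
  a+a≤1+n with m + m ≤? suc n
  ... | yes p = p
  ... | no ¬p = ⊥-elim (3≰2 (*-cancelˡ-< (suc c) m 2 (≤-trans last<n n≤2[1+c])))
    where
    identity : ∀ c → suc c + suc c ≡ suc (suc (c * 2))
    identity = solve-∀
    n≤2[1+c] : n ≤ suc c * 2
    n≤2[1+c] = ≤-pred (≤-pred (≤-trans (≰⇒> ¬p) (≤-reflexive (identity (suc c)))))

blockSplit-odd : ∀ n m → 4 ≤ suc (m + m) → IsCeil2Sqrt n (suc (m + m)) → BlockSplit n (suc (m + m))
blockSplit-odd n zero (s≤s ())
blockSplit-odd n (suc zero) (s≤s (s≤s (s≤s ())))
blockSplit-odd n (suc (suc c)) _ ceil = record
  { a = suc m ; b = m ; a+b≡k = refl ; 2≤a = s≤s (s≤s z≤n) ; a+a≤1+n = a+a≤1+n ; blocks<n = blocks<n ; n≤ba = n≤ba }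
  where
  m = suc (suc c)
  odd² : ∀ m → suc (m + m) * suc (m + m) ≡ suc (4 * (m * suc m))
  odd² = solve-∀
  n≤ba : n ≤ m * suc m
  n≤ba with n ≤? m * suc m
  ... | yes p = p
  ... | no ¬p = ⊥-elim (<-irrefl refl (≤-trans (≤-trans (4x+2≤4[1+x] (m * suc m)) (*-monoʳ-≤ 4 (≰⇒> ¬p)))
                                                (≤-trans (proj₁ ceil) (≤-reflexive (odd² m)))))
    where
    identity : ∀ x → 4 * suc x ≡ suc (suc (4 * x)) + 2
    identity = solve-∀
    4x+2≤4[1+x] : ∀ x → suc (suc (4 * x)) ≤ 4 * suc x
    4x+2≤4[1+x] x = ≤-trans (m≤m+n _ 2) (≤-reflexive (sym (identity x)))
  [m+m]²≡4m² : ∀ m → (m + m) * (m + m) ≡ 4 * (m * m)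
  [m+m]²≡4m² = solve-∀
  m²<n : m * m < n
  m²<n = *-cancelˡ-< 4 _ _ (≤-trans (≤-reflexive (cong suc (sym ([m+m]²≡4m² m))))
                                    (ceil2Sqrt-minimal {n} {m + m} ceil))
  [1+c]²≡1+c[2+c] : ∀ c → suc c * suc c ≡ suc (c * suc (suc c))
  [1+c]²≡1+c[2+c] = solve-∀
  blocks<n : ∀ j → j < m → j * suc m < n
  blocks<n j j<m = ≤-<-trans (*-monoˡ-≤ (suc m) (≤-pred j<m))
                             (<-trans (≤-reflexive (sym ([1+c]²≡1+c[2+c] (suc c)))) m²<n)
  a+a≤1+n : suc m + suc m ≤ suc n
  a+a≤1+n with suc m + suc m ≤? suc n
  ... | yes p = p
  ... | no ¬p = ⊥-elim (3≰2 (*-cancelˡ-< m m 2 (≤-trans m²<n n≤2m)))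
    where
    identity : ∀ c → suc c + suc c ≡ suc (suc (c * 2))
    identity = solve-∀
    n≤2m : n ≤ m * 2
    n≤2m = ≤-pred (≤-pred (≤-trans (≰⇒> ¬p) (≤-reflexive (identity m))))

blockSplit : ∀ n k → 3 ≤ n → IsCeil2Sqrt n k → BlockSplit n k
blockSplit n k 3≤n ceil with parity k | ceil2Sqrt≥4 {n} {k} 3≤n (proj₁ ceil)
... | m , inj₁ refl | 4≤k = blockSplit-even n m 4≤k ceil
... | m , inj₂ refl | 4≤k = blockSplit-odd n m 4≤k ceil

strongGeodeticSet-of-size : ∀ n r k → 3 ≤ n → IsCeil2Sqrt n k → 2 ≤ r →
  Σ (List (Fin r × Fin n)) λ S → Unique S × length S ≡ k × StrongGeodetic (Box (PathAdj r) (CycleAdj n)) S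
strongGeodeticSet-of-size n r k 3≤n ceil 2≤r =
  let S , unique , length≡a+b , sg = UpperBound.strongGeodeticSet r n a b fl 2≤r (n/2+n/2≤n n) (n≤1+n/2+n/2 n)
                                                                 2≤a a≤fl+1 fl+a≤n blocks<n n≤ba
  in S , unique , trans length≡a+b a+b≡k , sg
  where
  open BlockSplit (blockSplit n k 3≤n ceil)
  fl = n / 2
  fl+a≤n : fl + a ≤ n
  fl+a≤n = x+x≤1+y+y⇒x≤y (fl + a) n
             (≤-trans (≤-reflexive (interchange fl a fl a))
                      (≤-trans (+-mono-≤ (n/2+n/2≤n n) a+a≤1+n) (≤-reflexive (+-suc n n))))
  a≤fl+1 : a ≤ suc fl
  a≤fl+1 = x+x≤1+y+y⇒x≤y a (suc fl)
             (≤-trans a+a≤1+n (≤-trans (s≤s (n≤1+n/2+n/2 n))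
                                       (≤-trans (≤-reflexive (cong suc (sym (+-suc fl fl)))) (n≤1+n _))))

strongGeodetic⇒k≤length : ∀ n r k → IsCeil2Sqrt n k → (k C 2) * (n / 2) + k < r →
  (S : List (Fin r × Fin n)) → StrongGeodetic (Box (PathAdj r) (CycleAdj n)) S → k ≤ length S
strongGeodetic⇒k≤length n r k ceil r>bound S (g , cover) with k ≤? length S
... | yes k≤s = k≤s
... | no k≰s  = ⊥-elim (<-irrefl refl (<-≤-trans r>bound (≤-trans r≤ bound≤)))
  where
  s = length S
  s<k = ≰⇒> k≰s
  r≤ : r ≤ s + n / 2 * (s C 2)
  r≤ = LowerBound.lowerBound r n S g cover (≰⇒> (λ 4n≤s² → k≰s (proj₂ ceil s 4n≤s²)))
  bound≤ : s + n / 2 * (s C 2) ≤ (k C 2) * (n / 2) + k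
  bound≤ = ≤-trans (+-mono-≤ (<⇒≤ s<k) (*-monoʳ-≤ (n / 2) (C2-mono (<⇒≤ s<k))))
                   (≤-reflexive (trans (+-comm k _) (cong (_+ k) (*-comm (n / 2) (k C 2)))))

theorem3p4 : (n r k : ℕ) → 3 ≤ n → IsCeil2Sqrt n k
    → (k C 2) * (n / 2) + k < r
    → SgEq (Box (PathAdj r) (CycleAdj n)) k
theorem3p4 n r k 3≤n ceil r>bound =
  strongGeodeticSet-of-size n r k 3≤n ceil 2≤r ,
  λ S _ → strongGeodetic⇒k≤length n r k ceil r>bound S
  where
  2≤r : 2 ≤ r
  2≤r = ≤-trans (≤-trans (≤-trans (s≤s (s≤s z≤n)) (ceil2Sqrt≥4 {n} {k} 3≤n (proj₁ ceil))) (m≤n+m k _))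
                (<⇒≤ r>bound)
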